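{- For $n\ge 1$ let $\mathrm{PHP}_n$ be the positive sequent whose left-hand side consists of the $n+1$ formulas $\bigvee_{j=1}^n p_{i,j}$ for $i=1,\dots,n+1$, and whose right-hand side is the single formula $\bigvee_{j=1}^n\bigvee_{i=1}^n\bigvee_{i'=i+1}^{n+1}\mathrm{pd}(0,p_{i,j},p_{i',j})$, where the $p_{i,j}$ are distinct propositional variables. Then there are $\mathsf{posELNDT}$ proofs of $\mathrm{PHP}_n$ of size polynomial in $n$.
   Context: Language: propositional variables; Boolean constants $0,1$; extension variables $e_0,e_1,\dots$ distinct from propositional variables. eNDT formulas are generated from propositional variables, extension variables and constants by $\vee$ and decisions $\mathrm{dec}(A,p,B)$ ("if $p$ then $B$ else $A$") with $p$ a propositional variable. Write $\mathrm{pd}(A,p,C):=\mathrm{dec}(A,p,A\vee C)$ (semantically $A\vee(p\wedge C)$); a formula is positive if all its decision subformulas are of the form $\mathrm{pd}(A,p,C)$. A set of extension axioms is $\{e_i\leftrightarrow A_i\}_{i<n}$ with each $A_i$ mentioning only $e_0,\dots,e_{i-1}$ (well-founded infinite families are also allowed; a proof uses finitely many); $e\leftrightarrow A$ stands for the sequents $e\to A$ and $A\to e$. Sequents $\Gamma\to\Delta$ have multisets of formulas. $\mathsf{posELNDT}$ has: initial sequents $0\to$, $\to 1$, $p\to p$; cut (from $\Gamma\to\Delta,A$ and $\Gamma,A\to\Delta$ infer $\Gamma\to\Delta$); left/right weakening and contraction; $\vee$-left (from $\Gamma,A\to\Delta$ and $\Gamma,B\to\Delta$ infer $\Gamma,A\vee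 B\to\Delta$); $\vee$-right (from $\Gamma\to\Delta,A,B$ infer $\Gamma\to\Delta,A\vee B$); positive decision left (from $\Gamma,A\to\Delta$ and $\Gamma,p,B\to\Delta$ infer $\Gamma,\mathrm{pd}(A,p,B)\to\Delta$); positive decision right (from $\Gamma\to\Delta,A,p$ and $\Gamma\to\Delta,A,B$ infer $\Gamma\to\Delta,\mathrm{pd}(A,p,B)$). A proof is a finite list of sequents each being an extension axiom sequent from a set of positive extension axioms or following from earlier ones by a rule; all formulas must be positive and the final sequent must be free of extension variables. Size = number of symbols. -}

module Defs where

open import Data.Nat using (ℕ; zero; suc; _+_; _∸_; _<_)
open import Data.Product using (_×_; _,_; proj₁; proj₂)
open import Data.List using (List; []; _∷_; map)
open import Data.Nat.ListAction using (sum)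
open import Data.List.Relation.Unary.All using (All)
open import Data.List.Relation.Unary.Any using (Any)
open import Data.List.Relation.Binary.Permutation.Propositional using (_↭_)

data Fm (V : Set) : Set where
  var  : V → Fm V
  ext  : ℕ → Fm V
  𝟘    : Fm V
  𝟙    : Fm V
  _∨_  : Fm V → Fm V → Fm V
  dec  : Fm V → V → Fm V → Fm V         -- dec(A,p,B): if p then B else A

infixr 5 _∨_

module _ {V : Set} where

  pd : Fm V → V → Fm V → Fm V
  pd A p C = dec A p (A ∨ C)

  data Positive : Fm V → Set where
    pvar : ∀ p → Positive (var p)
    pext : ∀ i → Positive (ext i)
    p𝟘   : Positive 𝟘
    p𝟙   : Positive 𝟙
    p∨   : ∀ {A B} → Positive A → Positive B → Positive (A ∨ B)
    ppd  : ∀ {A C} p → Positive A → Positive C → Positive (pd A p C)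

  data ExtBelow (i : ℕ) : Fm V → Set where
    bvar : ∀ p → ExtBelow i (var p)
    bext : ∀ {j} → j < i → ExtBelow i (ext j)
    b𝟘   : ExtBelow i 𝟘
    b𝟙   : ExtBelow i 𝟙
    b∨   : ∀ {A B} → ExtBelow i A → ExtBelow i B → ExtBelow i (A ∨ B)
    bdec : ∀ {A B} p → ExtBelow i A → ExtBelow i B → ExtBelow i (dec A p B)

  -- Size = number of symbols (dec(A,p,B) counts the symbol dec and p).
  fsize : Fm V → ℕ
  fsize (var _)     = 1
  fsize (ext _)     = 1
  fsize 𝟘           = 1
  fsize 𝟙           = 1
  fsize (A ∨ B)     = 1 + fsize A + fsize B
  fsize (dec A _ B) = 2 + fsize A + fsize B

-- Sequents Γ → Δ; cedents are lists read as multisets (equality up to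
-- permutation, SeqEq).  "Γ , A" is written A ∷ Γ.

Sequent : Set → Set
Sequent V = List (Fm V) × List (Fm V)

module _ {V : Set} where

  SeqEq : Sequent V → Sequent V → Set
  SeqEq (Γ , Δ) (Γ' , Δ') = (Γ ↭ Γ') × (Δ ↭ Δ')

  ssize : Sequent V → ℕ
  ssize (Γ , Δ) = 1 + sum (map fsize Γ) + sum (map fsize Δ)

  PosSeq : Sequent V → Set
  PosSeq (Γ , Δ) = All Positive Γ × All Positive Δ

  data Inst : List (Sequent V) → Sequent V → Set where
    init0 : Inst [] (𝟘 ∷ [] , [])
    init1 : Inst [] ([] , 𝟙 ∷ [])
    initp : ∀ p → Inst [] (var p ∷ [] , var p ∷ [])
    cut   : ∀ Γ Δ A → Inst ((Γ , A ∷ Δ) ∷ (A ∷ Γ , Δ) ∷ []) (Γ , Δ)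
    wkL   : ∀ Γ Δ A → Inst ((Γ , Δ) ∷ []) (A ∷ Γ , Δ)
    wkR   : ∀ Γ Δ A → Inst ((Γ , Δ) ∷ []) (Γ , A ∷ Δ)
    ctrL  : ∀ Γ Δ A → Inst ((A ∷ A ∷ Γ , Δ) ∷ []) (A ∷ Γ , Δ)
    ctrR  : ∀ Γ Δ A → Inst ((Γ , A ∷ A ∷ Δ) ∷ []) (Γ , A ∷ Δ)
    ∨L    : ∀ Γ Δ A B → Inst ((A ∷ Γ , Δ) ∷ (B ∷ Γ , Δ) ∷ []) ((A ∨ B) ∷ Γ , Δ)
    ∨R    : ∀ Γ Δ A B → Inst ((Γ , A ∷ B ∷ Δ) ∷ []) (Γ , (A ∨ B) ∷ Δ)
    pdL   : ∀ Γ Δ A p B →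
            Inst ((A ∷ Γ , Δ) ∷ (var p ∷ B ∷ Γ , Δ) ∷ []) (pd A p B ∷ Γ , Δ)
    pdR   : ∀ Γ Δ A p B →
            Inst ((Γ , A ∷ var p ∷ Δ) ∷ (Γ , A ∷ B ∷ Δ) ∷ []) (Γ , pd A p B ∷ Δ)

  -- Extension axioms: E i is the formula A_i with e_i ↔ A_i.
  record ExtAxioms : Set where
    field
      defn   : ℕ → Fm V
      defPos : ∀ i → Positive (defn i)
      defWF  : ∀ i → ExtBelow i (defn i)
  open ExtAxioms public

  data Justified (E : ExtAxioms) (prev : List (Sequent V)) : Sequent V → Set where
    axL  : ∀ i → Justified E prev (ext i ∷ [] , defn E i ∷ [])
    axR  : ∀ i → Justified E prev (defn E i ∷ [] , ext i ∷ [])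
    rule : ∀ {ps c s} → Inst ps c → SeqEq c s →
           All (λ q → Any (SeqEq q) prev) ps → Justified E prev s

  -- Derivation E L : L (listed most recent first) is a valid posELNDT
  -- proof-list of sequents, all of whose formulas are positive.
  data Derivation (E : ExtAxioms) : List (Sequent V) → Set where
    []   : Derivation E []
    step : ∀ {prev s} → Derivation E prev → PosSeq s →
           Justified E prev s → Derivation E (s ∷ prev)

  record Proof (goal : Sequent V) : Set where
    field
      axioms  : ExtAxioms
      earlier : List (Sequent V)
      final   : Sequent V
      deriv   : Derivation axioms (final ∷ earlier)
      isGoal  : SeqEq final goal
  open Proof public

  proofSize : ∀ {goal} → Proof goal → ℕ
  proofSize π = sum (map ssize (final π ∷ earlier π))

-- a, a+1, ..., a+k-1
fromTo : ℕ → ℕ → List ℕ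
fromTo a zero    = []
fromTo a (suc k) = a ∷ fromTo (suc a) k

-- right-nested disjunction of a list (only used on nonempty lists)
⋁ : ∀ {V} → List (Fm V) → Fm V
⋁ []           = 𝟘
⋁ (A ∷ [])     = A
⋁ (A ∷ B ∷ As) = A ∨ ⋁ (B ∷ As)

P : ℕ → ℕ → Fm (ℕ × ℕ)
P i j = var (i , j)

PHP : ℕ → Sequent (ℕ × ℕ)
PHP n =
  map (λ i → ⋁ (map (λ j → P i j) (fromTo 1 n))) (fromTo 1 (suc n)) ,
  ⋁ (map (λ j →
        ⋁ (map (λ i →
              ⋁ (map (λ i' → pd 𝟘 (i , j) (P i' j)) (fromTo (suc i) (suc n ∸ i))))
           (fromTo 1 n)))
     (fromTo 1 n)) ∷ []

{-# OPTIONS --safe #-}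
module Submission where

-- Proof idea (a Cook-style counting argument).  Let N = n + 1 and write R for the
-- right-hand side of PHP_n.  Extension variables Count i k t, for a pigeon i, a number
-- k of holes and a count t, are defined by the positive recursion
--   Count i k 0 ↔ 1,   Count i 0 (t+1) ↔ 0,
--   Count i (k+1) (t+1) ↔ Count i k (t+1) ∨ ⋁_{i ≤ x ≤ N} pd(0, p_{x,n-k}, Count i k t),
-- so that, as long as no hole holds two pigeons, Count i k t says that at least t of
-- the pigeons i, …, N sit in the last k holes.  By induction on k one derives
--   Count (i+1) k t → Count i k t,
--   p_{i,n-k}, Count (i+1) l t → R, Count i l (t+1)   (k < l),
--   Count 1 k t →                                    (k < t),
-- where the second sequent needs R exactly when pigeon i shares its hole with a
-- later pigeon.  Eliminating the rows of PHP_n one at a time gives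
-- Rows → R, Count 1 n N, and a cut with Count 1 n N → yields PHP_n.  There are O(n⁴)
-- such sequents, each derived by a tree of O(n²) sequents with O(n) formulas of O(n³)
-- symbols, so the whole proof has size O(n¹⁰).

open import Defs
open import Data.Nat using (ℕ; zero; suc; _+_; _*_; _∸_; _^_; _≤_; _<_; z≤n; s≤s; _<?_; NonZero; _/_; _%_)
open import Data.Nat.Properties
open import Data.Nat.DivMod
open import Data.Nat.Divisibility using (divides-refl)
open import Data.Product using (Σ; _×_; _,_; proj₁; proj₂)
open import Data.List using (List; []; _∷_; map; _++_; length)
open import Data.Nat.ListAction using (sum)
open import Data.List.Relation.Unary.All as All using (All; []; _∷_)
open import Data.List.Relation.Unary.Any as Any using (Any; here; there)
import Data.List.Relation.Unary.Any.Properties as AnyP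
import Data.List.Relation.Unary.All.Properties as AllP
open import Data.List.Relation.Binary.Permutation.Propositional using (_↭_; ↭-refl; ↭-sym; ↭-trans; swap; prep; ↭-reflexive)
import Data.List.Relation.Binary.Permutation.Propositional.Properties as PermP
open import Relation.Binary.PropositionalEquality
open import Data.Nat.Tactic.RingSolver using (solve-∀)
open import Data.List.Properties using (length-++; ++-identityʳ; map-∘; map-cong)
open import Data.Empty using (⊥-elim)
open import Relation.Nullary using (yes; no)
open import Relation.Nullary.Decidable using (True; toWitness)

Var : Set
Var = ℕ × ℕ

-- Positive formulas, with pd as a primitive, so that positivity holds by construction.
infixr 5 _∨'_
data PosFm : Set where
  pv   : Var → PosFm
  pe   : ℕ → PosFm
  p0   : PosFm
  p1   : PosFm
  _∨'_ : PosFm → PosFm → PosFm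
  ppd  : PosFm → Var → PosFm → PosFm

emb : PosFm → Fm Var
emb (pv p)      = var p
emb (pe i)      = ext i
emb p0          = 𝟘
emb p1          = 𝟙
emb (A ∨' B)    = emb A ∨ emb B
emb (ppd A p C) = pd (emb A) p (emb C)

emb-positive : ∀ φ → Positive (emb φ)
emb-positive (pv p)      = pvar p
emb-positive (pe i)      = pext i
emb-positive p0          = p𝟘
emb-positive p1          = p𝟙
emb-positive (A ∨' B)    = p∨ (emb-positive A) (emb-positive B)
emb-positive (ppd A p C) = ppd p (emb-positive A) (emb-positive C)

size : PosFm → ℕ
size A = fsize (emb A)

size-∨ˡ : ∀ A B → size A ≤ size (A ∨' B)
size-∨ˡ A B = ≤-trans (m≤m+n (size A) (size B)) (n≤1+n _)

size-∨ʳ : ∀ A B → size B ≤ size (A ∨' B)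
size-∨ʳ A B = ≤-trans (m≤n+m (size B) (size A)) (n≤1+n _)

size-pd-body : ∀ p X → size X ≤ size (ppd p0 p X)
size-pd-body p X = m≤n+m (size X) 5

⋁P : List PosFm → PosFm
⋁P [] = p0
⋁P (A ∷ []) = A
⋁P (A ∷ B ∷ As) = A ∨' ⋁P (B ∷ As)

emb-⋁ : ∀ L → emb (⋁P L) ≡ ⋁ (map emb L)
emb-⋁ [] = refl
emb-⋁ (A ∷ []) = refl
emb-⋁ (A ∷ B ∷ As) = cong (emb A ∨_) (emb-⋁ (B ∷ As))

size-⋁P : ∀ L b → All (λ A → size A ≤ b) L → size (⋁P L) ≤ suc (length L * suc b)
size-⋁P [] b [] = ≤-refl
size-⋁P (A ∷ []) b (p ∷ []) = ≤-trans p (≤-trans (n≤1+n b) (≤-trans (≤-reflexive (sym (+-identityʳ (suc b)))) (n≤1+n _)))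
size-⋁P (A ∷ B ∷ As) b (p ∷ ps) = s≤s (≤-trans (+-mono-≤ p (size-⋁P (B ∷ As) b ps)) (≤-reflexive (lem b (length As))))
  where
  lem : ∀ b l → b + suc (suc l * suc b) ≡ suc (suc l) * suc b
  lem = solve-∀

PSequent : Set
PSequent = List PosFm × List PosFm

embSeq : PSequent → Sequent Var
embSeq (Γ , Δ) = map emb Γ , map emb Δ
data PosRule : List PSequent → PSequent → Set where
  init0 : PosRule [] (p0 ∷ [] , [])
  init1 : PosRule [] ([] , p1 ∷ [])
  initp : ∀ p → PosRule [] (pv p ∷ [] , pv p ∷ [])
  cut   : ∀ Γ Δ A → PosRule ((Γ , A ∷ Δ) ∷ (A ∷ Γ , Δ) ∷ []) (Γ , Δ)
  wkL   : ∀ Γ Δ A → PosRule ((Γ , Δ) ∷ []) (A ∷ Γ , Δ)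
  wkR   : ∀ Γ Δ A → PosRule ((Γ , Δ) ∷ []) (Γ , A ∷ Δ)
  ctrL  : ∀ Γ Δ A → PosRule ((A ∷ A ∷ Γ , Δ) ∷ []) (A ∷ Γ , Δ)
  ctrR  : ∀ Γ Δ A → PosRule ((Γ , A ∷ A ∷ Δ) ∷ []) (Γ , A ∷ Δ)
  ∨L    : ∀ Γ Δ A B → PosRule ((A ∷ Γ , Δ) ∷ (B ∷ Γ , Δ) ∷ []) ((A ∨' B) ∷ Γ , Δ)
  ∨R    : ∀ Γ Δ A B → PosRule ((Γ , A ∷ B ∷ Δ) ∷ []) (Γ , (A ∨' B) ∷ Δ)
  pdL   : ∀ Γ Δ A p B →
          PosRule ((A ∷ Γ , Δ) ∷ (pv p ∷ B ∷ Γ , Δ) ∷ []) (ppd A p B ∷ Γ , Δ)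
  pdR   : ∀ Γ Δ A p B →
          PosRule ((Γ , A ∷ pv p ∷ Δ) ∷ (Γ , A ∷ B ∷ Δ) ∷ []) (Γ , ppd A p B ∷ Δ)

emb-rule : ∀ {ps c} → PosRule ps c → Inst (map embSeq ps) (embSeq c)
emb-rule init0 = init0
emb-rule init1 = init1
emb-rule (initp p) = initp p
emb-rule (cut Γ Δ A) = cut (map emb Γ) (map emb Δ) (emb A)
emb-rule (wkL Γ Δ A) = wkL (map emb Γ) (map emb Δ) (emb A)
emb-rule (wkR Γ Δ A) = wkR (map emb Γ) (map emb Δ) (emb A)
emb-rule (ctrL Γ Δ A) = ctrL (map emb Γ) (map emb Δ) (emb A)
emb-rule (ctrR Γ Δ A) = ctrR (map emb Γ) (map emb Δ) (emb A)
emb-rule (∨L Γ Δ A B) = ∨L (map emb Γ) (map emb Δ) (emb A) (emb B)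
emb-rule (∨R Γ Δ A B) = ∨R (map emb Γ) (map emb Δ) (emb A) (emb B)
emb-rule (pdL Γ Δ A p B) = pdL (map emb Γ) (map emb Δ) (emb A) p (emb B)
emb-rule (pdR Γ Δ A p B) = pdR (map emb Γ) (map emb Δ) (emb A) p (emb B)

infix 4 _≈_
_≈_ : PSequent → PSequent → Set
(Γ , Δ) ≈ (Γ' , Δ') = (Γ ↭ Γ') × (Δ ↭ Δ')

≈-refl : ∀ {s} → s ≈ s
≈-refl = ↭-refl , ↭-refl

≈-sym : ∀ {s t} → s ≈ t → t ≈ s
≈-sym {_ , _} {_ , _} (a , b) = ↭-sym a , ↭-sym b

≈-trans : ∀ {s t u} → s ≈ t → t ≈ u → s ≈ u
≈-trans {_ , _} {_ , _} {_ , _} (a , b) (c , d) = ↭-trans a c , ↭-trans b d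

emb-≈ : ∀ {s t} → s ≈ t → SeqEq (embSeq s) (embSeq t)
emb-≈ {_ , _} {_ , _} (a , b) = PermP.map⁺ emb a , PermP.map⁺ emb b

Has : List PSequent → PSequent → Set
Has L s = Any (s ≈_) L

emb-Has : ∀ {L s} → Has L s → Any (SeqEq (embSeq s)) (map embSeq L)
emb-Has h = AnyP.map⁺ (Any.map emb-≈ h)

-- Extends L L' k: L' is L with k more sequents on top (lists are most recent first).
infixl 6 _▷_
data Extends (L : List PSequent) : List PSequent → ℕ → Set where
  ε   : Extends L L 0
  _▷_ : ∀ {L' k} → Extends L L' k → (s : PSequent) → Extends L (s ∷ L') (suc k)

extends-trans : ∀ {L1 L2 L3 k1 k2} → Extends L1 L2 k1 → Extends L2 L3 k2 → Extends L1 L3 (k2 + k1)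
extends-trans e ε = e
extends-trans e (e2 ▷ s) = extends-trans e e2 ▷ s

Has-extends : ∀ {L L' k s} → Extends L L' k → Has L s → Has L' s
Has-extends ε h = h
Has-extends (e ▷ _) h = there (Has-extends e h)

extends-length : ∀ {L L' k} → Extends L L' k → length L' ≡ k + length L
extends-length ε = refl
extends-length (e ▷ s) = cong suc (extends-length e)

module Trees (defn-at : ℕ → PosFm) (defn-wf : ∀ i → ExtBelow i (emb (defn-at i))) (F K : ℕ) where

  E : ExtAxioms
  E = record { defn = λ i → emb (defn-at i) ; defPos = λ i → emb-positive (defn-at i) ; defWF = defn-wf }

  Small : PosFm → Set
  Small A = size A ≤ F

  -- FitsWith c s: the formulas of s have size at most F and there is room for c more
  -- of them (such as a cut formula) within the bound K on the number of formulas.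
  FitsWith : ℕ → PSequent → Set
  FitsWith c (Γ , Δ) = (All Small Γ × All Small Δ) × (c + (length Γ + length Δ) ≤ K)

  Fits : PSequent → Set
  Fits = FitsWith 0

  fitsWith-resp-≈ : ∀ {c s t} → s ≈ t → FitsWith c s → FitsWith c t
  fitsWith-resp-≈ {c} {_ , _} {_ , _} (a , b) ((x , y) , l) =
    (PermP.All-resp-↭ a x , PermP.All-resp-↭ b y) ,
    subst₂ (λ u v → c + (u + v) ≤ K) (PermP.↭-length a) (PermP.↭-length b) l

  fits-resp-≈ : ∀ {s t} → s ≈ t → Fits s → Fits t
  fits-resp-≈ = fitsWith-resp-≈ {0}

  fits-dropL : ∀ {A Γ Δ} → Fits (A ∷ Γ , Δ) → Fits (Γ , Δ)
  fits-dropL ((_ ∷ x , y) , l) = (x , y) , ≤-trans (n≤1+n _) l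

  fits-dropR : ∀ {A Γ Δ} → Fits (Γ , A ∷ Δ) → Fits (Γ , Δ)
  fits-dropR {A} {Γ} {Δ} ((x , _ ∷ y) , l) =
    (x , y) , ≤-trans (+-monoʳ-≤ (length Γ) (n≤1+n _)) l

  -- An extension axiom is not closed under permutation, so axl/axr pay for a weakening
  -- and a contraction that produce a permuted copy.
  data Tree (L : List PSequent) : ℕ → PSequent → Set where
    ref : ∀ {s} → Has L s → Tree L 0 s
    axl : ∀ c {s} → (pe c ∷ [] , defn-at c ∷ []) ≈ s →
          Fits (pe c ∷ pe c ∷ [] , defn-at c ∷ []) → Tree L 3 s
    axr : ∀ c {s} → (defn-at c ∷ [] , pe c ∷ []) ≈ s →
          Fits (defn-at c ∷ [] , pe c ∷ pe c ∷ []) → Tree L 3 s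
    nd0 : ∀ {c s} → PosRule [] c → c ≈ s → Fits s → Tree L 1 s
    nd1 : ∀ {p c s k} → PosRule (p ∷ []) c → c ≈ s → Fits s → Tree L k p → Tree L (suc k) s
    nd2 : ∀ {p q c s k1 k2} → PosRule (p ∷ q ∷ []) c → c ≈ s → Fits s →
          Tree L k1 p → Tree L k2 q → Tree L (suc (k1 + k2)) s

  Valid : List PSequent → Set
  Valid L = Derivation E (map embSeq L) × All Fits L

  positive-seq : ∀ {s} → PosSeq (embSeq s)
  positive-seq {Γ , Δ} = allPos Γ , allPos Δ
    where
    allPos : ∀ Γ → All Positive (map emb Γ)
    allPos [] = []
    allPos (A ∷ Γ) = emb-positive A ∷ allPos Γ

  push : ∀ {L s ps c} → Valid L → PosRule ps c → c ≈ s → Fits s →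
         All (Has L) ps → Valid (s ∷ L)
  push {L} (d , a) i eq o hs =
    step d positive-seq (rule (emb-rule i) (emb-≈ eq) (allE hs)) , o ∷ a
    where
    allE : ∀ {ps} → All (Has L) ps → All (λ q → Any (SeqEq q) (map embSeq L)) (map embSeq ps)
    allE [] = []
    allE (h ∷ hs) = emb-Has h ∷ allE hs

  Output : List PSequent → ℕ → PSequent → Set
  Output L k s = Σ (List PSequent) λ L' → Valid L' × Extends L L' k × Has L' s

  linearise' : ∀ {L k s L0 j} → Tree L k s → Extends L L0 j → Valid L0 → Output L0 k s
  linearise' (ref h) e st = _ , st , ε , Has-extends e h
  linearise' (axl c {s} eq o) _ (d , a) =
    let o2 = fits-dropL o
        st1 = step d positive-seq (axL c) , o2 ∷ a
        st2 = push st1 (wkL (pe c ∷ []) (defn-at c ∷ []) (pe c)) ≈-refl o (here ≈-refl ∷ [])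
        st3 = push st2 (ctrL [] (defn-at c ∷ []) (pe c)) eq (fits-resp-≈ eq o2) (here ≈-refl ∷ [])
    in _ , st3 , ε ▷ _ ▷ _ ▷ s , here ≈-refl
  linearise' (axr c {s} eq o) _ (d , a) =
    let o2 = fits-dropR o
        st1 = step d positive-seq (axR c) , o2 ∷ a
        st2 = push st1 (wkR (defn-at c ∷ []) (pe c ∷ []) (pe c)) ≈-refl o (here ≈-refl ∷ [])
        st3 = push st2 (ctrR (defn-at c ∷ []) [] (pe c)) eq (fits-resp-≈ eq o2) (here ≈-refl ∷ [])
    in _ , st3 , ε ▷ _ ▷ _ ▷ s , here ≈-refl
  linearise' (nd0 {s = s} i eq o) _ st = _ , push st i eq o [] , ε ▷ s , here ≈-refl
  linearise' (nd1 {s = s} i eq o t) e st with linearise' t e st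
  ... | L1 , st1 , e1 , h1 = _ , push st1 i eq o (h1 ∷ []) , e1 ▷ s , here ≈-refl
  linearise' (nd2 {s = s} {k1 = k1} {k2} i eq o t u) e st with linearise' t e st
  ... | L1 , st1 , e1 , h1 with linearise' u (extends-trans e e1) st1
  ... | L2 , st2 , e2 , h2 =
    _ , push st2 i eq o (Has-extends e2 h1 ∷ h2 ∷ []) ,
    subst (Extends _ L2) (+-comm k2 k1) (extends-trans e1 e2) ▷ s , here ≈-refl

  linearise : ∀ {L k s} → Tree L k s → Valid L → Output L k s
  linearise t = linearise' t ε

  tree-resp-≈ : ∀ {L k s s'} → Tree L k s → s ≈ s' → Fits s' → Tree L k s'
  tree-resp-≈ (ref h) e o = ref (Any.map (λ x → ≈-trans (≈-sym e) x) h)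
  tree-resp-≈ (axl c x o) e _ = axl c (≈-trans x e) o
  tree-resp-≈ (axr c x o) e o' = axr c (≈-trans x e) o
  tree-resp-≈ (nd0 i x _) e o = nd0 i (≈-trans x e) o
  tree-resp-≈ (nd1 i x _ t) e o = nd1 i (≈-trans x e) o t
  tree-resp-≈ (nd2 i x _ t u) e o = nd2 i (≈-trans x e) o t u

  Tree≤ : List PSequent → ℕ → PSequent → Set
  Tree≤ L b s = Σ ℕ λ k → Tree L k s × k ≤ b

  relax : ∀ {L b b' s} → b ≤ b' → Tree≤ L b s → Tree≤ L b' s
  relax le (k , t , p) = k , t , ≤-trans p le

  listed : ∀ {L s} → Has L s → Tree≤ L 0 s
  listed h = 0 , ref h , z≤n

  rule₀ : ∀ {L c s} → PosRule [] c → c ≈ s → Fits s → Tree≤ L 1 s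
  rule₀ i e o = 1 , nd0 i e o , ≤-refl

  rule₁ : ∀ {L p c s b} → PosRule (p ∷ []) c → c ≈ s → Fits s → Tree≤ L b p → Tree≤ L (suc b) s
  rule₁ i e o (k , t , le) = suc k , nd1 i e o t , s≤s le

  rule₂ : ∀ {L p q c s b1 b2} → PosRule (p ∷ q ∷ []) c → c ≈ s → Fits s →
       Tree≤ L b1 p → Tree≤ L b2 q → Tree≤ L (suc (b1 + b2)) s
  rule₂ i e o (k , t , le) (k' , t' , le') = suc (k + k') , nd2 i e o t t' , s≤s (+-mono-≤ le le')

  reorder : ∀ {L b s s'} → Tree≤ L b s → s ≈ s' → Fits s' → Tree≤ L b s'
  reorder (k , t , le) e o = k , tree-resp-≈ t e o , le

  axiomL : ∀ {L} c → Fits (pe c ∷ pe c ∷ [] , defn-at c ∷ []) → Tree≤ L 3 (pe c ∷ [] , defn-at c ∷ [])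
  axiomL c o = 3 , axl c ≈-refl o , ≤-refl

  axiomR : ∀ {L} c → Fits (defn-at c ∷ [] , pe c ∷ pe c ∷ []) → Tree≤ L 3 (defn-at c ∷ [] , pe c ∷ [])
  axiomR c o = 3 , axr c ≈-refl o , ≤-refl

  len-lem : ∀ a b c d e → a + b ≤ c → c + (d + e) ≤ K → (a + d) + (b + e) ≤ K
  len-lem a b c d e p q = ≤-trans (≤-reflexive (eq a b d e)) (≤-trans (+-monoˡ-≤ (d + e) p) q)
    where
    eq : ∀ a b d e → (a + d) + (b + e) ≡ (a + b) + (d + e)
    eq = solve-∀

  fits-++ : ∀ xs ys {c Γ Δ} → All Small xs → All Small ys → length xs + length ys ≤ c →
          FitsWith c (Γ , Δ) → Fits (xs ++ Γ , ys ++ Δ)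
  fits-++ xs ys {c} {Γ} {Δ} fx fy l ((fΓ , fΔ) , l') =
    (AllP.++⁺ fx fΓ , AllP.++⁺ fy fΔ) ,
    subst₂ (λ u v → u + v ≤ K) (sym (length-++ xs)) (sym (length-++ ys))
      (len-lem (length xs) (length ys) c (length Γ) (length Δ) l l')

  fitsWith-weaken : ∀ {c c' s} → c' ≤ c → FitsWith c s → FitsWith c' s
  fitsWith-weaken {s = _ , _} le (f , l) = f , ≤-trans (+-monoˡ-≤ _ le) l

  fitsWith⇒fits : ∀ {c s} → FitsWith c s → Fits s
  fitsWith⇒fits {c} = fitsWith-weaken {c} {0} z≤n

  fits-dropLs : ∀ xs {Γ Δ} → Fits (xs ++ Γ , Δ) → Fits (Γ , Δ)
  fits-dropLs [] o = o
  fits-dropLs (x ∷ xs) o = fits-dropLs xs (fits-dropL o)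

  fits-shrinkL : ∀ {A B Γ Δ} → size B ≤ size A → Fits (A ∷ Γ , Δ) → Fits (B ∷ Γ , Δ)
  fits-shrinkL le ((fa ∷ fΓ , fΔ) , l) = (≤-trans le fa ∷ fΓ , fΔ) , l

  fitsWith-shrinkR : ∀ {c A B Γ Δ} → size B ≤ size A → FitsWith c (Γ , A ∷ Δ) → FitsWith c (Γ , B ∷ Δ)
  fitsWith-shrinkR le ((fΓ , fa ∷ fΔ) , l) = (fΓ , ≤-trans le fa ∷ fΔ) , l

  weakenL* : ∀ {L} xs {Γ Δ b} → Tree≤ L b (Γ , Δ) → Fits (xs ++ Γ , Δ) → Tree≤ L (length xs + b) (xs ++ Γ , Δ)
  weakenL* [] t o = t
  weakenL* (x ∷ xs) {Γ} {Δ} t o = rule₁ (wkL (xs ++ Γ) Δ x) ≈-refl o (weakenL* xs t (fits-dropL o))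

  weakenR* : ∀ {L} ys {Γ Δ b} → Tree≤ L b (Γ , Δ) → Fits (Γ , ys ++ Δ) → Tree≤ L (length ys + b) (Γ , ys ++ Δ)
  weakenR* [] t o = t
  weakenR* (y ∷ ys) {Γ} {Δ} t o = rule₁ (wkR Γ (ys ++ Δ) y) ≈-refl o (weakenR* ys t (fits-dropR o))

  weaken : ∀ {L} xs ys {Γ Δ b} → Tree≤ L b (Γ , Δ) → Fits (xs ++ Γ , ys ++ Δ) →
         Tree≤ L (length xs + (length ys + b)) (xs ++ Γ , ys ++ Δ)
  weaken xs ys t o = weakenL* xs (weakenR* ys t (fits-dropLs xs o)) o

  ⋁L-lem : ∀ m b → suc (b + (m + suc m * b)) ≡ suc m + suc (suc m) * b
  ⋁L-lem = solve-∀

  ⋁-left⁺ : ∀ {L b Γ Δ} A As → All (λ X → Tree≤ L b (X ∷ Γ , Δ)) (A ∷ As) →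
          Fits (⋁P (A ∷ As) ∷ Γ , Δ) → Tree≤ L (length As + length (A ∷ As) * b) (⋁P (A ∷ As) ∷ Γ , Δ)
  ⋁-left⁺ {b = b} A [] (t ∷ []) o = relax (≤-reflexive (sym (+-identityʳ b))) t
  ⋁-left⁺ {b = b} {Γ} {Δ} A (B ∷ As) (t ∷ ts) o =
    relax (≤-reflexive (⋁L-lem (length As) b))
      (rule₂ (∨L Γ Δ A (⋁P (B ∷ As))) ≈-refl o t
          (⋁-left⁺ B As ts (fits-shrinkL (size-∨ʳ A (⋁P (B ∷ As))) o)))

  fitsWith-split∨ : ∀ {A X Γ Δ} → FitsWith 1 (Γ , (A ∨' X) ∷ Δ) → Fits (Γ , A ∷ X ∷ Δ)
  fitsWith-split∨ {A} {X} {Γ} {Δ} ((fΓ , f ∷ fΔ) , l) =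
    (fΓ , ≤-trans (size-∨ˡ A X) f ∷ ≤-trans (size-∨ʳ A X) f ∷ fΔ) ,
    ≤-trans (≤-reflexive (+-suc (length Γ) (suc (length Δ)))) l

  ⋁-right⁺ : ∀ {L b Γ Δ} A As → Any (λ X → Tree≤ L b (Γ , X ∷ Δ)) (A ∷ As) →
           FitsWith 1 (Γ , ⋁P (A ∷ As) ∷ Δ) → Tree≤ L (b + 2 * length As) (Γ , ⋁P (A ∷ As) ∷ Δ)
  ⋁-right⁺ {b = b} A [] (here t) o = relax (≤-reflexive (sym (+-identityʳ b))) t
  ⋁-right⁺ {b = b} {Γ} {Δ} A (B ∷ As) (here t) o =
    relax (≤-trans (≤-reflexive (+-comm 2 b)) (+-monoʳ-≤ b (*-monoʳ-≤ 2 (s≤s z≤n))))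
      (rule₁ (∨R Γ Δ A X) ≈-refl (fitsWith⇒fits {1} o)
        (rule₁ (wkR Γ (A ∷ Δ) X) (↭-refl , swap X A ↭-refl) (fitsWith-split∨ o) t))
    where
    X = ⋁P (B ∷ As)
  ⋁-right⁺ {b = b} {Γ} {Δ} A (B ∷ As) (there p) o =
    relax (≤-reflexive (lem b (length As)))
      (rule₁ (∨R Γ Δ A X) ≈-refl (fitsWith⇒fits {1} o)
        (rule₁ (wkR Γ (X ∷ Δ) A) ≈-refl (fitsWith-split∨ o)
          (⋁-right⁺ B As p (fitsWith-shrinkR {c = 1} (size-∨ʳ A X) o))))
    where
    X = ⋁P (B ∷ As)
    lem : ∀ b m → suc (suc (b + 2 * m)) ≡ b + 2 * suc m
    lem = solve-∀

  fitsWith-split : ∀ {A B Z Γ Δ} → size A ≤ size Z → size B ≤ size Z → FitsWith 1 (Γ , Z ∷ Δ) → Fits (Γ , A ∷ B ∷ Δ)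
  fitsWith-split {A} {B} {Z} {Γ} {Δ} a b ((fΓ , f ∷ fΔ) , l) =
    (fΓ , ≤-trans a f ∷ ≤-trans b f ∷ fΔ) ,
    ≤-trans (≤-reflexive (+-suc (length Γ) (suc (length Δ)))) l

  0-left : ∀ {L Γ Δ} → Fits (p0 ∷ Γ , Δ) → Tree≤ L (length Γ + (length Δ + 1)) (p0 ∷ Γ , Δ)
  0-left {L} {Γ} {Δ} o@((f0 ∷ _ , _) , l) =
    reorder (weaken Γ Δ (rule₀ init0 ≈-refl ok0) (fits-resp-≈ (≈-sym eq) o)) eq o
    where
    ok0 : Fits (p0 ∷ [] , [])
    ok0 = (f0 ∷ [] , []) , ≤-trans (s≤s z≤n) l
    eq : (Γ ++ p0 ∷ [] , Δ ++ []) ≈ (p0 ∷ Γ , Δ)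
    eq = PermP.++-comm Γ (p0 ∷ []) , ↭-reflexive (++-identityʳ Δ)

  pd0-left : ∀ {L b p X Γ Δ} → Tree≤ L b (pv p ∷ X ∷ Γ , Δ) → Fits (ppd p0 p X ∷ Γ , Δ) →
           Tree≤ L (suc ((length Γ + (length Δ + 1)) + b)) (ppd p0 p X ∷ Γ , Δ)
  pd0-left {p = p} {X} {Γ} {Δ} t o =
    rule₂ (pdL Γ Δ p0 p X) ≈-refl o (0-left (fits-shrinkL (s≤s z≤n) o)) t

  pd0-right : ∀ {L b1 b2 p X Γ Δ} → Tree≤ L b1 (Γ , pv p ∷ Δ) → Tree≤ L b2 (Γ , X ∷ Δ) →
            FitsWith 1 (Γ , ppd p0 p X ∷ Δ) → Tree≤ L (suc (suc b1 + suc b2)) (Γ , ppd p0 p X ∷ Δ)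
  pd0-right {p = p} {X} {Γ} {Δ} t u o =
    rule₂ (pdR Γ Δ p0 p X) ≈-refl (fitsWith⇒fits {1} o)
      (rule₁ (wkR Γ (pv p ∷ Δ) p0) ≈-refl (fitsWith-split (s≤s z≤n) (s≤s z≤n) o) t)
      (rule₁ (wkR Γ (X ∷ Δ) p0) ≈-refl (fitsWith-split (s≤s z≤n) (size-pd-body p X) o) u)

  cut-merge : ∀ {L b1 b2 A Γ1 Δ1 Γ2 Δ2} → Tree≤ L b1 (Γ1 , A ∷ Δ1) → Tree≤ L b2 (A ∷ Γ2 , Δ2) → Small A →
         FitsWith 1 (Γ1 ++ Γ2 , Δ1 ++ Δ2) →
         Tree≤ L (suc ((length Γ2 + (length Δ2 + b1)) + (length Γ1 + (length Δ1 + b2)))) (Γ1 ++ Γ2 , Δ1 ++ Δ2)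
  cut-merge {A = A} {Γ1} {Δ1} {Γ2} {Δ2} t1 t2 fa o =
    rule₂ (cut (Γ1 ++ Γ2) (Δ1 ++ Δ2) A) ≈-refl (fitsWith⇒fits {1} o)
       (reorder (weaken Γ2 Δ2 t1 (fits-resp-≈ (≈-sym e1) o1)) e1 o1)
       (reorder (weaken Γ1 Δ1 t2 (fits-resp-≈ (≈-sym e2) o2)) e2 o2)
    where
    e1 : (Γ2 ++ Γ1 , Δ2 ++ A ∷ Δ1) ≈ (Γ1 ++ Γ2 , A ∷ Δ1 ++ Δ2)
    e1 = PermP.++-comm Γ2 Γ1 , PermP.++-comm Δ2 (A ∷ Δ1)
    e2 : (Γ1 ++ A ∷ Γ2 , Δ1 ++ Δ2) ≈ (A ∷ Γ1 ++ Γ2 , Δ1 ++ Δ2)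
    e2 = PermP.shift A Γ1 Γ2 , ↭-refl
    o1 : Fits (Γ1 ++ Γ2 , A ∷ Δ1 ++ Δ2)
    o1 = fits-++ [] (A ∷ []) [] (fa ∷ []) ≤-refl o
    o2 : Fits (A ∷ Γ1 ++ Γ2 , Δ1 ++ Δ2)
    o2 = fits-++ (A ∷ []) [] (fa ∷ []) [] ≤-refl o

  ⋁-left : ∀ {L b Γ Δ} Ls → All (λ X → Tree≤ L b (X ∷ Γ , Δ)) Ls →
           Fits (⋁P Ls ∷ Γ , Δ) → Tree≤ L (length Ls * suc b + suc K) (⋁P Ls ∷ Γ , Δ)
  ⋁-left {Γ = Γ} {Δ} [] [] o@(_ , l) =
    relax (≤-trans (≤-reflexive (lem (length Γ) (length Δ))) (≤-trans l (n≤1+n K))) (0-left o)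
    where
    lem : ∀ a b → a + (b + 1) ≡ suc (a + b)
    lem = solve-∀
  ⋁-left {b = b} (A ∷ As) ts o =
    relax (≤-trans (m≤m+n _ 1) (≤-trans (≤-reflexive (lem (length As) b)) (m≤m+n _ (suc K))))
      (⋁-left⁺ A As ts o)
    where
    lem : ∀ m b → (m + suc m * b) + 1 ≡ suc m * suc b
    lem = solve-∀

  ⋁-right : ∀ {L b Γ Δ} Ls → Any (λ X → Tree≤ L b (Γ , X ∷ Δ)) Ls →
            FitsWith 1 (Γ , ⋁P Ls ∷ Δ) → Tree≤ L (b + 2 * length Ls) (Γ , ⋁P Ls ∷ Δ)
  ⋁-right {b = b} (A ∷ As) p o = relax (+-monoʳ-≤ b (*-monoʳ-≤ 2 (n≤1+n _))) (⋁-right⁺ A As p o)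

  Extends≤ : List PSequent → List PSequent → ℕ → Set
  Extends≤ L L' b = Σ ℕ λ k → Extends L L' k × k ≤ b

  extends≤-trans : ∀ {L1 L2 L3 b1 b2} → Extends≤ L1 L2 b1 → Extends≤ L2 L3 b2 → Extends≤ L1 L3 (b1 + b2)
  extends≤-trans {b1 = b1} (k1 , e1 , q1) (k2 , e2 , q2) =
    k2 + k1 , extends-trans e1 e2 , ≤-trans (+-mono-≤ q2 q1) (≤-reflexive (+-comm _ b1))

  extends≤-relax : ∀ {L L' b b'} → b ≤ b' → Extends≤ L L' b → Extends≤ L L' b'
  extends≤-relax le (k , e , p) = k , e , ≤-trans p le

  extends≤⇒extends : ∀ {L L' b} → Extends≤ L L' b → Σ ℕ (Extends L L')
  extends≤⇒extends (k , e , _) = k , e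

  Result : List PSequent → ℕ → (List PSequent → Set) → Set
  Result L b Q = Σ (List PSequent) λ L' → Valid L' × Extends≤ L L' b × Q L'

  nothing-new : ∀ {L b} {Q : List PSequent → Set} → Valid L → Q L → Result L b Q
  nothing-new st q = _ , st , (0 , ε , z≤n) , q

  bind : ∀ {L b b'} {Q Q' : List PSequent → Set} → Result L b Q →
         (∀ {L'} → Σ ℕ (Extends L L') → Valid L' → Q L' → Result L' b' Q') → Result L (b + b') Q'
  bind (L' , st , g , q) f with f (extends≤⇒extends g) st q
  ... | L'' , st' , g' , q' = L'' , st' , extends≤-trans g g' , q'

  Result-map : ∀ {L b} {Q Q' : List PSequent → Set} → (∀ {L'} → Q L' → Q' L') → Result L b Q → Result L b Q'
  Result-map f (L' , st , g , q) = L' , st , g , f q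

  record-tree : ∀ {L b s} → Tree≤ L b s → Valid L → Result L b (λ L' → Has L' s)
  record-tree (k , t , le) st with linearise t st
  ... | L' , st' , e , h = L' , st' , (k , e , le) , h

  Monotone : (ℕ → List PSequent → Set) → Set
  Monotone Inv = ∀ {x L L' k} → Extends L L' k → Inv x L → Inv x L'

  iterate : ∀ m {L0} (Inv : ℕ → List PSequent → Set) → Monotone Inv → (b : ℕ) →
    (∀ x → x < m → ∀ {L k} → Extends L0 L k → Valid L → (∀ y → y < x → Inv y L) → Result L b (Inv x)) →
    Valid L0 → Result L0 (m * b) (λ L' → ∀ y → y < m → Inv y L')
  iterate zero Inv mono b stp st = _ , st , (0 , ε , z≤n) , λ y y<0 → ⊥-elim (n≮0 y<0)
  iterate (suc m) Inv mono b stp st with iterate m Inv mono b (λ x x<m → stp x (≤-trans x<m (n≤1+n m))) st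
  ... | L1 , st1 , g1 , inv1 with stp m ≤-refl (proj₂ (extends≤⇒extends g1)) st1 inv1
  ... | L2 , st2 , g2 , inv2 =
    L2 , st2 , extends≤-relax (≤-reflexive (+-comm (m * b) b)) (extends≤-trans g1 g2) , fin
    where
    fin : ∀ y → y < suc m → Inv y L2
    fin y y<sm with y <? m
    ... | yes y<m = mono (proj₁ (proj₂ g2)) (inv1 y y<m)
    ... | no y≮m rewrite ≤-antisym (≤-pred y<sm) (≮⇒≥ y≮m) = inv2

  extract : ∀ {L s} → Valid L → Has L s →
    Σ PSequent λ s'' → Σ (List PSequent) λ ys → (s ≈ s'') × Derivation E (map embSeq (s'' ∷ ys)) × All Fits (s'' ∷ ys) × length ys < length L
  extract {x ∷ L} (d , o ∷ os) (here eq) = x , L , eq , d , o ∷ os , ≤-refl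
  extract {x ∷ L} (step d _ _ , o ∷ os) (there h) with extract (d , os) h
  ... | s'' , ys , eq , d' , os' , le = s'' , ys , eq , d' , os' , ≤-trans le (n≤1+n _)

  sum-fsize-small : ∀ Γ → All Small Γ → sum (map fsize (map emb Γ)) ≤ length Γ * F
  sum-fsize-small [] [] = z≤n
  sum-fsize-small (A ∷ Γ) (f ∷ fs) = +-mono-≤ f (sum-fsize-small Γ fs)

  ssize-fits : ∀ s → Fits s → ssize (embSeq s) ≤ suc (K * F)
  ssize-fits (Γ , Δ) ((fΓ , fΔ) , l) = s≤s (≤-trans (≤-trans (+-mono-≤ (sum-fsize-small Γ fΓ) (sum-fsize-small Δ fΔ))
      (≤-reflexive (sym (*-distribʳ-+ F (length Γ) (length Δ))))) (*-monoˡ-≤ F l))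

  sum-ssize-valid : ∀ L → All Fits L → sum (map ssize (map embSeq L)) ≤ length L * suc (K * F)
  sum-ssize-valid [] [] = z≤n
  sum-ssize-valid (s ∷ L) (o ∷ os) = +-mono-≤ (ssize-fits s o) (sum-ssize-valid L os)


  proof-from-list : ∀ {L s} → Valid L → Has L s →
                    Σ (Proof (embSeq s)) λ π → proofSize π ≤ length L * suc (K * F)
  proof-from-list st h with extract st h
  ... | s' , ys , eq , d , fits , le =
    record { axioms = E ; earlier = map embSeq ys ; final = embSeq s' ; deriv = d ; isGoal = emb-≈ (≈-sym eq) } ,
    ≤-trans (sum-ssize-valid (s' ∷ ys) fits) (*-monoˡ-≤ (suc (K * F)) le)
decode-div : ∀ r q d .{{_ : NonZero d}} → r < d → (r + q * d) / d ≡ q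
decode-div r q d r<d = begin
  (r + q * d) / d ≡⟨ +-distrib-/-∣ʳ r (divides-refl q) ⟩
  r / d + q * d / d ≡⟨ cong₂ _+_ (m<n⇒m/n≡0 r<d) (m*n/n≡m q d) ⟩
  q ∎
  where open ≡-Reasoning

decode-mod : ∀ r q d .{{_ : NonZero d}} → r < d → (r + q * d) % d ≡ r
decode-mod r q d r<d = trans ([m+kn]%n≡m%n r q d) (m<n⇒m%n≡m r<d)

ExtBelow-⋁ : ∀ {c} L → All (λ A → ExtBelow c (emb A)) L → ExtBelow c (emb (⋁P L))
ExtBelow-⋁ [] [] = b𝟘
ExtBelow-⋁ (A ∷ []) (a ∷ []) = a
ExtBelow-⋁ (A ∷ B ∷ As) (a ∷ as) = b∨ a (ExtBelow-⋁ (B ∷ As) as)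

Any-map-fromTo : ∀ {A : Set} {P : A → Set} (f : ℕ → A) a m x → a ≤ x → x < a + m → P (f x) → Any P (map f (fromTo a m))
Any-map-fromTo f a zero x a≤x x< = ⊥-elim (<-irrefl refl (≤-trans (s≤s a≤x) (subst (_≤_ (suc x)) (+-identityʳ a) x<)))
Any-map-fromTo f a (suc m) x a≤x x< p with a ≟ x
... | yes refl = here p
... | no a≢x = there (Any-map-fromTo f (suc a) m x (≤∧≢⇒< a≤x a≢x) (subst (x <_) (+-suc a m) x<) p)

All-map-fromTo : ∀ {A : Set} {P : A → Set} (f : ℕ → A) a m → (∀ x → a ≤ x → x < a + m → P (f x)) → All P (map f (fromTo a m))
All-map-fromTo f a zero h = []
All-map-fromTo f a (suc m) h = h a ≤-refl (subst (a <_) (sym (+-suc a m)) (s≤s (m≤m+n a m))) ∷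
  All-map-fromTo f (suc a) m (λ x a<x x< → h x (≤-trans (n≤1+n a) a<x) (subst (x <_) (sym (+-suc a m)) x<))

length-map-fromTo : ∀ {A : Set} (f : ℕ → A) a m → length (map f (fromTo a m)) ≡ m
length-map-fromTo f a zero = refl
length-map-fromTo f a (suc m) = cong suc (length-map-fromTo f (suc a) m)

emb-⋁-map : ∀ (f : ℕ → PosFm) (g : ℕ → Fm Var) → (∀ x → emb (f x) ≡ g x) → ∀ xs → emb (⋁P (map f xs)) ≡ ⋁ (map g xs)
emb-⋁-map f g h xs = trans (emb-⋁ (map f xs)) (cong ⋁ (trans (sym (map-∘ xs)) (map-cong h xs)))

module Counting (n : ℕ) where
  N : ℕ
  N = suc n

  Base : ℕ
  Base = suc (suc N)

  Block : ℕ
  Block = Base * Base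

  -- Count i k t is the extension variable e_(index i k t).  As i, t < Base, the
  -- variables in the definition of Count i (k+1) (t+1) have a smaller index.
  index : ℕ → ℕ → ℕ → ℕ
  index i k t = (t + i * Base) + k * Block

  Count : ℕ → ℕ → ℕ → PosFm
  Count i k t = pe (index i k t)

  placed : ℕ → ℕ → ℕ → ℕ → PosFm
  placed i k t i' = ppd p0 (i' , n ∸ k) (Count i k t)

  placements : ℕ → ℕ → ℕ → List PosFm
  placements i k t = map (placed i k t) (fromTo i (suc N ∸ i))

  disjuncts : ℕ → ℕ → ℕ → List PosFm
  disjuncts i k t = Count i k (suc t) ∷ placements i k t

  CountDef : ℕ → ℕ → ℕ → PosFm
  CountDef i k t = ⋁P (disjuncts i k t)

  some-placement : ∀ {P : PosFm → Set} i k t x → i ≤ x → x ≤ N → P (placed i k t x) → Any P (disjuncts i k t)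
  some-placement i k t x i≤x x≤N p =
    there (Any-map-fromTo (placed i k t) i (suc N ∸ i) x i≤x
            (subst (x <_) (sym (m+[n∸m]≡n (≤-trans i≤x (≤-trans x≤N (n≤1+n N))))) (s≤s x≤N)) p)

  count-body : ℕ → ℕ → ℕ → PosFm
  count-body k i zero = p1
  count-body zero i (suc t) = p0
  count-body (suc k) i (suc t) = CountDef i k t

  defn-at : ℕ → PosFm
  defn-at c = count-body (c / Block) ((c % Block) / Base) ((c % Block) % Base)

  low<Block : ∀ i t → i < Base → t < Base → t + i * Base < Block
  low<Block i t i< t< = begin-strict
    t + i * Base <⟨ +-monoˡ-< (i * Base) t< ⟩
    Base + i * Base ≡⟨⟩
    suc i * Base ≤⟨ *-monoˡ-≤ Base i< ⟩
    Block ∎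
    where open ≤-Reasoning

  decode-defn : ∀ i k t → i < Base → t < Base → defn-at (index i k t) ≡ count-body k i t
  decode-defn i k t i< t< =
    trans (cong (λ r → count-body ((t + i * Base + k * Block) / Block) (r / Base) (r % Base)) (decode-mod _ k Block (low<Block i t i< t<)))
      (cong₂ (λ a b → count-body a b (((t + i * Base)) % Base)) (decode-div _ k Block (low<Block i t i< t<)) (decode-div t i Base t<)
      ∙ cong (count-body k i) (decode-mod t i Base t<))
    where
    _∙_ = trans

  index< : ∀ i k t t' → i < Base → t' < Base → index i k t' < index i (suc k) t
  index< i k t t' i< t'< = begin-strict
    (t' + i * Base) + k * Block <⟨ +-monoˡ-< (k * Block) (low<Block i t' i< t'<) ⟩
    Block + k * Block ≤⟨ m≤n+m (Block + k * Block) (t + i * Base) ⟩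
    (t + i * Base) + (Block + k * Block) ∎
    where open ≤-Reasoning

  ExtBelow-placements : ∀ c i k t → index i k t < c → (js : List ℕ) →
    All (λ A → ExtBelow c (emb A)) (map (placed i k t) js)
  ExtBelow-placements c i k t lt [] = []
  ExtBelow-placements c i k t lt (j ∷ js) = bdec _ b𝟘 (b∨ b𝟘 (bext lt)) ∷ ExtBelow-placements c i k t lt js

  ExtBelow-count-body : ∀ k i t → i < Base → t < Base → ExtBelow (index i k t) (emb (count-body k i t))
  ExtBelow-count-body k i zero _ _ = b𝟙
  ExtBelow-count-body zero i (suc t) _ _ = b𝟘
  ExtBelow-count-body (suc k) i (suc t) i< t< =
    ExtBelow-⋁ (Count i k (suc t) ∷ placements i k t)
      (bext (index< i k (suc t) (suc t) i< t<) ∷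
       ExtBelow-placements _ i k t (index< i k (suc t) t i< (≤-trans (n≤1+n _) t<)) (fromTo i (suc N ∸ i)))

  defn-wf : ∀ c → ExtBelow c (emb (defn-at c))
  defn-wf c = subst (λ x → ExtBelow x (emb (count-body k i t))) (sym ceq) (ExtBelow-count-body k i t i< t<)
    where
    r = c % Block
    k = c / Block
    i = r / Base
    t = r % Base
    r<W : r < Block
    r<W = m%n<n c Block
    i< : i < Base
    i< = *-cancelʳ-< Base i Base (≤-<-trans (m/n*n≤m r Base) r<W)
    t< : t < Base
    t< = m%n<n r Base
    ceq : c ≡ index i k t
    ceq = trans (m≡m%n+[m/n]*n c Block) (cong (_+ k * Block) (m≡m%n+[m/n]*n r Base))

  Pig : ℕ → ℕ → PosFm
  Pig i j = pv (i , j)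

  Row : ℕ → PosFm
  Row i = ⋁P (map (Pig i) (fromTo 1 n))

  Both : ℕ → ℕ → ℕ → PosFm
  Both i j i' = ppd p0 (i , j) (Pig i' j)

  clashesWith : ℕ → ℕ → List PosFm
  clashesWith j i = map (Both i j) (fromTo (suc i) (suc n ∸ i))

  ClashWith : ℕ → ℕ → PosFm
  ClashWith j i = ⋁P (clashesWith j i)

  holeClashes : ℕ → List PosFm
  holeClashes j = map (ClashWith j) (fromTo 1 n)

  HoleClash : ℕ → PosFm
  HoleClash j = ⋁P (holeClashes j)

  allClashes : List PosFm
  allClashes = map HoleClash (fromTo 1 n)

  AnyClash : PosFm
  AnyClash = ⋁P allClashes

  Rows : ℕ → ℕ → List PosFm
  Rows a m = map Row (fromTo a m)

  Goal : PSequent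
  Goal = Rows 1 N , AnyClash ∷ []

  embSeq-Goal : embSeq Goal ≡ PHP n
  embSeq-Goal = cong₂ _,_ rows (cong (_∷ []) clashes)
    where
    rows = trans (sym (map-∘ (fromTo 1 N))) (map-cong (λ i → emb-⋁-map (Pig i) (P i) (λ j → refl) (fromTo 1 n)) (fromTo 1 N))
    clashes = emb-⋁-map HoleClash _ (λ j → emb-⋁-map (ClashWith j) _ (λ i → emb-⋁-map (Both i j) _ (λ i' → refl) (fromTo (suc i) (suc n ∸ i))) (fromTo 1 n)) (fromTo 1 n)

  record SizeBounds (F K : ℕ) : Set where
    field
      small-AnyClash   : size AnyClash ≤ F
      small-HoleClash   : ∀ j → size (HoleClash j) ≤ F
      small-ClashWith   : ∀ j i → size (ClashWith j i) ≤ F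
      small-Row : ∀ i → size (Row i) ≤ F
      small-CountDef   : ∀ i k t → size (CountDef i k t) ≤ F
      6≤F   : 6 ≤ F
      N+8≤K   : N + 8 ≤ K

  module Construction (F K : ℕ) (hy : SizeBounds F K) where
    open SizeBounds hy
    open Trees defn-at defn-wf F K

    1≤F : 1 ≤ F
    1≤F = ≤-trans (s≤s z≤n) 6≤F

    small-Count : ∀ i k t → Small (Count i k t)
    small-Count i k t = 1≤F

    small-Pig : ∀ i j → Small (Pig i j)
    small-Pig i j = 1≤F

    small-0 : Small p0
    small-0 = 1≤F

    small-1 : Small p1
    small-1 = 1≤F

    small-placed : ∀ x j i k t → Small (ppd p0 (x , j) (Count i k t))
    small-placed x j i k t = 6≤F

    small-Both : ∀ i j i' → Small (Both i j i')
    small-Both i j i' = 6≤F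

    small-count-body : ∀ k i t → Small (count-body k i t)
    small-count-body k i zero = small-1
    small-count-body zero i (suc t) = small-0
    small-count-body (suc k) i (suc t) = small-CountDef i k t

    ≤8⇒≤K : ∀ {m} → m ≤ 8 → m ≤ K
    ≤8⇒≤K le = ≤-trans le (≤-trans (m≤n+m 8 N) N+8≤K)

    -- The local derivations only use sequents of at most 8 formulas.
    lit≤K : ∀ {m} {w : True (m ≤? 8)} → m ≤ K
    lit≤K {w = w} = ≤8⇒≤K (toWitness w)

    N<K : suc N ≤ K
    N<K = ≤-trans (≤-trans (≤-reflexive (+-comm 1 N)) (+-monoʳ-≤ N (s≤s z≤n))) N+8≤K

    unfoldL : ∀ {L} i k t → i ≤ suc N → t ≤ suc N → Tree≤ L 3 (Count i k t ∷ [] , count-body k i t ∷ [])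
    unfoldL {L} i k t i≤ t≤ =
      subst (λ X → Tree≤ L 3 (Count i k t ∷ [] , X ∷ [])) dq
        (axiomL (index i k t) ((1≤F ∷ 1≤F ∷ [] , subst Small (sym dq) (small-count-body k i t) ∷ []) , lit≤K))
      where dq = decode-defn i k t (s≤s i≤) (s≤s t≤)

    unfoldR : ∀ {L} i k t → i ≤ suc N → t ≤ suc N → Tree≤ L 3 (count-body k i t ∷ [] , Count i k t ∷ [])
    unfoldR {L} i k t i≤ t≤ =
      subst (λ X → Tree≤ L 3 (X ∷ [] , Count i k t ∷ [])) dq
        (axiomR (index i k t) ((subst Small (sym dq) (small-count-body k i t) ∷ [] , 1≤F ∷ 1≤F ∷ []) , lit≤K))
      where dq = decode-defn i k t (s≤s i≤) (s≤s t≤)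

    length-clashesWith : ∀ j i → length (clashesWith j i) ≤ K
    length-clashesWith j i = ≤-trans (≤-reflexive (length-map-fromTo (Both i j) (suc i) (suc n ∸ i)))
                  (≤-trans (m∸n≤m (suc n) i) (≤-trans (n≤1+n _) N<K))

    length-holeClashes : ∀ j → length (holeClashes j) ≤ K
    length-holeClashes j = ≤-trans (≤-reflexive (length-map-fromTo (ClashWith j) 1 n)) (≤-trans (n≤1+n _) (≤-trans (n≤1+n _) N<K))

    length-allClashes : length allClashes ≤ K
    length-allClashes = ≤-trans (≤-reflexive (length-map-fromTo HoleClash 1 n)) (≤-trans (n≤1+n _) (≤-trans (n≤1+n _) N<K))

    clash-bound : ∀ x y z → x ≤ K → y ≤ K → z ≤ K → ((7 + 2 * x) + 2 * y) + 2 * z ≤ 7 + 6 * K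
    clash-bound x y z p q r =
      ≤-trans (+-mono-≤ (+-mono-≤ (+-monoʳ-≤ 7 (*-monoʳ-≤ 2 p)) (*-monoʳ-≤ 2 q)) (*-monoʳ-≤ 2 r))
        (≤-reflexive (lem K))
      where
      lem : ∀ k → ((7 + 2 * k) + 2 * k) + 2 * k ≡ 7 + 6 * k
      lem = solve-∀

    clash : ∀ {L} a b h → 1 ≤ a → a < b → b ≤ N → 1 ≤ h → h ≤ n →
           Tree≤ L (7 + 6 * K) (Pig a h ∷ Pig b h ∷ [] , AnyClash ∷ [])
    clash a b h 1≤a a<b b≤N 1≤h h≤n =
      relax (clash-bound _ _ _ (length-clashesWith h a) (length-holeClashes h) length-allClashes)
        (⋁-right allClashes (Any-map-fromTo HoleClash 1 n h 1≤h (s≤s h≤n)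
          (⋁-right (holeClashes h) (Any-map-fromTo (ClashWith h) 1 n a 1≤a (s≤s a≤n)
            (⋁-right (clashesWith h a) (Any-map-fromTo (Both a h) (suc a) (suc n ∸ a) b a<b b<end both)
              (fits (small-ClashWith h a))))
            (fits (small-HoleClash h))))
          (fits (small-AnyClash)))
      where
      fits : ∀ {A} → Small A → FitsWith 1 (Pig a h ∷ Pig b h ∷ [] , A ∷ [])
      fits s = (small-Pig a h ∷ small-Pig b h ∷ [] , s ∷ []) , lit≤K
      a≤n : a ≤ n
      a≤n = ≤-pred (≤-trans a<b b≤N)
      b<end : b < suc a + (suc n ∸ a)
      b<end = subst (b <_) (sym (cong suc (m+[n∸m]≡n (≤-trans a≤n (n≤1+n n))))) (s≤s b≤N)
      both = pd0-right
        (rule₁ (wkL (Pig a h ∷ []) (Pig a h ∷ []) (Pig b h)) (swap _ _ ↭-refl , ↭-refl) (fitsWith⇒fits {1} (fits (small-Pig a h)))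
          (rule₀ (initp (a , h)) ≈-refl ((small-Pig a h ∷ [] , small-Pig a h ∷ []) , lit≤K)))
        (rule₁ (wkL (Pig b h ∷ []) (Pig b h ∷ []) (Pig a h)) ≈-refl (fitsWith⇒fits {1} (fits (small-Pig b h)))
          (rule₀ (initp (b , h)) ≈-refl ((small-Pig b h ∷ [] , small-Pig b h ∷ []) , lit≤K)))
        (fits (small-Both a h b))

    lit≤ : ∀ {a b} {w : True (a ≤? b)} → a ≤ b
    lit≤ {w = w} = toWitness w

    N+2≤K : suc (suc N) ≤ K
    N+2≤K = ≤-trans (≤-trans (≤-reflexive (+-comm 2 N)) (+-monoʳ-≤ N (s≤s (s≤s z≤n)))) N+8≤K

    length-disjuncts : ∀ i k t → length (disjuncts i k t) ≤ K
    length-disjuncts i k t = ≤-trans (s≤s (≤-trans (≤-reflexive (length-map-fromTo (placed i k t) i (suc N ∸ i))) (m∸n≤m (suc N) i))) N+2≤K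

    K≥1 : 1 ≤ K
    K≥1 = ≤8⇒≤K (s≤s z≤n)

    K≤K*K : K ≤ K * K
    K≤K*K = ≤-trans (≤-reflexive (sym (*-identityʳ K))) (*-monoʳ-≤ K K≥1)

    1≤K*K : 1 ≤ K * K
    1≤K*K = ≤-trans K≥1 K≤K*K

    Cap : ℕ
    Cap = 60 * (K * K)

    ≤Cap : ∀ a b c → a + b + c ≤ 60 → a * (K * K) + b * K + c ≤ Cap
    ≤Cap a b c le = ≤-trans (+-mono-≤ (+-monoʳ-≤ (a * (K * K)) (*-monoʳ-≤ b K≤K*K)) (≤-trans (≤-reflexive (sym (*-identityʳ c))) (*-monoʳ-≤ c 1≤K*K)))
      (≤-trans (≤-reflexive (lem a b c (K * K))) (*-monoˡ-≤ (K * K) le))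
      where
      lem : ∀ a b c x → a * x + b * x + c * x ≡ (a + b + c) * x
      lem = solve-∀

    Count-left : ∀ {L b Γ Δ} i k t → i ≤ suc N → suc t ≤ suc N →
      Tree≤ L b (Count i k (suc t) ∷ Γ , Δ) →
      (∀ x → i ≤ x → x ≤ N → Tree≤ L b (placed i k t x ∷ Γ , Δ)) →
      Fits (CountDef i k t ∷ Γ , Δ) → FitsWith 1 (Count i (suc k) (suc t) ∷ Γ , Δ) →
      Tree≤ L (length Γ + length Δ + K * suc b + (K + 6)) (Count i (suc k) (suc t) ∷ Γ , Δ)
    Count-left {L} {b} {Γ} {Δ} i k t i≤ t≤ first rest fitsDef fits =
      relax bound
        (cut-merge {Γ1 = Count i (suc k) (suc t) ∷ []} {[]} (unfoldL i (suc k) (suc t) i≤ t≤)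
          (⋁-left (disjuncts i k t) (first ∷ All-map-fromTo (placed i k t) i (suc N ∸ i) rest') fitsDef)
          (small-CountDef i k t) fits)
      where
      rest' : ∀ x → i ≤ x → x < i + (suc N ∸ i) → Tree≤ L b (placed i k t x ∷ Γ , Δ)
      rest' x i≤x x< = rest x i≤x (≤-pred (subst (x <_) (m+[n∸m]≡n i≤) x<))
      bound : suc ((length Γ + (length Δ + 3)) + (1 + (0 + (length (disjuncts i k t) * suc b + suc K))))
              ≤ length Γ + length Δ + K * suc b + (K + 6)
      bound = ≤-trans (≤-reflexive (lem (length Γ) (length Δ) (length (disjuncts i k t)) b K))
                (+-monoˡ-≤ (K + 6) (+-monoʳ-≤ (length Γ + length Δ) (*-monoˡ-≤ (suc b) (length-disjuncts i k t))))
        where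
        lem : ∀ g d l b k → suc ((g + (d + 3)) + (1 + (0 + (l * suc b + suc k)))) ≡ g + d + l * suc b + (k + 6)
        lem = solve-∀

    Count-right : ∀ {L b Γ Δ} i k t → i ≤ suc N → suc t ≤ suc N →
      Any (λ X → Tree≤ L b (Γ , X ∷ Δ)) (disjuncts i k t) →
      FitsWith 1 (Γ , CountDef i k t ∷ Δ) → FitsWith 1 (Γ , Count i (suc k) (suc t) ∷ Δ) →
      Tree≤ L (length Γ + length Δ + b + (2 * K + 5)) (Γ , Count i (suc k) (suc t) ∷ Δ)
    Count-right {b = b} {Γ} {Δ} i k t i≤ t≤ some fitsDef fits =
      relax bound
        (reorder (cut-merge {Γ1 = Γ} {Δ} {[]} (⋁-right (disjuncts i k t) some fitsDef) (unfoldR i (suc k) (suc t) i≤ t≤)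
                    (small-CountDef i k t) (fitsWith-resp-≈ {1} (≈-sym moveCount) fits))
                 moveCount (fitsWith⇒fits {1} fits))
      where
      C = Count i (suc k) (suc t)
      moveCount : (Γ ++ [] , Δ ++ C ∷ []) ≈ (Γ , C ∷ Δ)
      moveCount = ↭-reflexive (++-identityʳ Γ) , PermP.++-comm Δ (C ∷ [])
      bound : suc ((0 + (1 + (b + 2 * length (disjuncts i k t)))) + (length Γ + (length Δ + 3)))
              ≤ length Γ + length Δ + b + (2 * K + 5)
      bound = ≤-trans (≤-reflexive (lem (length Γ) (length Δ) b (length (disjuncts i k t))))
                (+-monoʳ-≤ (length Γ + length Δ + b) (+-monoˡ-≤ 5 (*-monoʳ-≤ 2 (length-disjuncts i k t))))
        where
        lem : ∀ g d b l → suc ((0 + (1 + (b + 2 * l))) + (g + (d + 3))) ≡ g + d + b + (2 * l + 5)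
        lem = solve-∀

    Count-left≤Cap : ∀ g a c → a + c + g ≤ 50 → g + K * suc (a * K + c) + (K + 6) ≤ Cap
    Count-left≤Cap g a c le =
      ≤-trans (≤-reflexive (lem g a c K)) (≤Cap a (c + 2) (g + 6) (≤-trans (≤-reflexive (lem' g a c)) (≤-trans (+-monoʳ-≤ 8 le) (lit≤ {58} {60}))))
      where
      lem : ∀ g a c k → g + k * suc (a * k + c) + (k + 6) ≡ a * (k * k) + (c + 2) * k + (g + 6)
      lem = solve-∀
      lem' : ∀ g a c → a + (c + 2) + (g + 6) ≡ 8 + (a + c + g)
      lem' = solve-∀

    Count-right≤Cap : ∀ m → m ≤ 50 → m + (2 * K + 5) ≤ Cap
    Count-right≤Cap m le = ≤-trans (≤-reflexive (lem m K)) (≤Cap 0 2 (m + 5) (s≤s (s≤s (+-monoˡ-≤ 5 (≤-trans le (lit≤ {50} {53}))))))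
      where
      lem : ∀ m k → m + (2 * k + 5) ≡ 0 * (k * k) + 2 * k + (m + 5)
      lem = solve-∀

    shift≤ : ∀ x a b c → a + b ≤ c → a + (x + b) ≤ x + c
    shift≤ x a b c le = ≤-trans (≤-reflexive (lem x a b)) (+-monoʳ-≤ x le)
      where
      lem : ∀ x a b → a + (x + b) ≡ x + (a + b)
      lem = solve-∀

    Count-zero : ∀ {L} i k → i ≤ suc N → Tree≤ L 6 ([] , Count i k 0 ∷ [])
    Count-zero i k i≤ =
      cut-merge {Γ1 = []} {[]} {[]} {Count i k 0 ∷ []} (rule₀ init1 ≈-refl (([] , small-1 ∷ []) , lit≤K))
        (unfoldR i k 0 i≤ z≤n) small-1 (([] , small-Count i k 0 ∷ []) , lit≤K)

    MonoSeq : ℕ → ℕ → ℕ → PSequent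
    MonoSeq i k t = Count (suc i) k t ∷ [] , Count i k t ∷ []

    count-mono-base : ∀ {L} i k t → count-body k (suc i) t ≡ count-body k i t → i ≤ N → t ≤ suc N → Tree≤ L 9 (MonoSeq i k t)
    count-mono-base {L} i k t eq i≤ t≤ =
      cut-merge (unfoldL (suc i) k t (s≤s i≤) t≤)
           (subst (λ X → Tree≤ L 3 (X ∷ [] , Count i k t ∷ [])) (sym eq) (unfoldR i k t (≤-trans i≤ (n≤1+n _)) t≤))
           (small-count-body k (suc i) t) ((small-Count (suc i) k t ∷ [] , small-Count i k t ∷ []) , lit≤K)

    count-mono-step : ∀ {L} i k t → i ≤ N → suc t ≤ suc N →
            Has L (MonoSeq i k (suc t)) → Has L (MonoSeq i k t) → Tree≤ L Cap (MonoSeq i (suc k) (suc t))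
    count-mono-step {L} i k t i≤ t≤ above below =
      relax (Count-left≤Cap 1 2 16 lit≤)
        (Count-left (suc i) k t (s≤s i≤) t≤ first rest
          ((small-CountDef (suc i) k t ∷ [] , small-Count i (suc k) (suc t) ∷ []) , lit≤K)
          ((small-Count (suc i) (suc k) (suc t) ∷ [] , small-Count i (suc k) (suc t) ∷ []) , lit≤K))
      where
      i≤' = ≤-trans i≤ (n≤1+n _)
      h = n ∸ k
      C = Count i (suc k) (suc t)
      fits-C : ∀ {A} → Small A → FitsWith 1 (A ∷ [] , C ∷ [])
      fits-C a = (a ∷ [] , small-Count i (suc k) (suc t) ∷ []) , lit≤K
      first : Tree≤ L (2 * K + 16) (Count (suc i) k (suc t) ∷ [] , C ∷ [])
      first = relax (shift≤ (2 * K) 1 5 16 lit≤)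
        (Count-right i k t i≤' t≤ (here (listed above))
          ((small-Count (suc i) k (suc t) ∷ [] , small-CountDef i k t ∷ []) , lit≤K) (fits-C (small-Count (suc i) k (suc t))))
      rest : ∀ x → suc i ≤ x → x ≤ N → Tree≤ L (2 * K + 16) (placed (suc i) k t x ∷ [] , C ∷ [])
      rest x i<x x≤N = relax (shift≤ (2 * K) 11 5 16 lit≤) (pd0-left collect (fitsWith⇒fits {1} (fits-C (small-placed x h (suc i) k t))))
        where
        X1 = Count (suc i) k t
        Γ = Pig x h ∷ X1 ∷ []
        fitsΓ : ∀ {A} → Small A → FitsWith 1 (Γ , A ∷ [])
        fitsΓ a = (small-Pig x h ∷ small-Count (suc i) k t ∷ [] , a ∷ []) , lit≤K
        u0 = rule₁ (wkL (Pig x h ∷ []) (Pig x h ∷ []) X1) (swap _ _ ↭-refl , ↭-refl) (fitsWith⇒fits {1} (fitsΓ (small-Pig x h)))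
               (rule₀ (initp (x , h)) ≈-refl ((small-Pig x h ∷ [] , small-Pig x h ∷ []) , lit≤K))
        u1 = rule₁ (wkL (X1 ∷ []) (Count i k t ∷ []) (Pig x h)) ≈-refl (fitsWith⇒fits {1} (fitsΓ (small-Count i k t))) (listed below)
        collect = Count-right i k t i≤' t≤
          (some-placement i k t x (≤-trans (n≤1+n i) i<x) x≤N (pd0-right u0 u1 (fitsΓ (small-placed x h i k t))))
          (fitsΓ (small-CountDef i k t)) (fitsΓ (small-Count i (suc k) (suc t)))

    PigeonSeq : ℕ → ℕ → ℕ → PSequent
    PigeonSeq i k l = Pig i (n ∸ k) ∷ [] , Count i l 1 ∷ []

    pigeon-counts-base : ∀ {L} i k → i ≤ N → Tree≤ L Cap (PigeonSeq i k (suc k))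
    pigeon-counts-base {L} i k i≤ =
      relax (Count-right≤Cap 12 lit≤)
        (Count-right i k 0 i≤' (s≤s z≤n) (some-placement i k 0 i ≤-refl i≤ placed-here) (fits (small-CountDef i k 0)) (fits (small-Count i (suc k) 1)))
      where
      h = n ∸ k
      i≤' = ≤-trans i≤ (n≤1+n _)
      fits : ∀ {A} → Small A → FitsWith 1 (Pig i h ∷ [] , A ∷ [])
      fits a = (small-Pig i h ∷ [] , a ∷ []) , lit≤K
      placed-here : Tree≤ L 11 (Pig i h ∷ [] , placed i k 0 i ∷ [])
      placed-here =
        pd0-right (rule₀ (initp (i , h)) ≈-refl (fitsWith⇒fits {1} (fits (small-Pig i h))))
          (rule₁ (wkL [] (Count i k 0 ∷ []) (Pig i h)) ≈-refl (fitsWith⇒fits {1} (fits (small-Count i k 0))) (Count-zero i k i≤'))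
          (fits (small-placed i h i k 0))

    pigeon-counts-step : ∀ {L} i k l → i ≤ N → Has L (PigeonSeq i k l) → Tree≤ L Cap (PigeonSeq i k (suc l))
    pigeon-counts-step {L} i k l i≤ hp =
      relax (Count-right≤Cap 1 lit≤)
        (Count-right i l 0 (≤-trans i≤ (n≤1+n _)) (s≤s z≤n) (here (listed hp))
          ((small-Pig i (n ∸ k) ∷ [] , small-CountDef i l 0 ∷ []) , lit≤K) ((small-Pig i (n ∸ k) ∷ [] , small-Count i (suc l) 1 ∷ []) , lit≤K))

    StepSeq : ℕ → ℕ → ℕ → ℕ → PSequent
    StepSeq i k l t = Pig i (n ∸ k) ∷ Count (suc i) l t ∷ [] , AnyClash ∷ Count i l (suc t) ∷ []

    count-step-zero : ∀ {L} i k l → Has L (PigeonSeq i k l) → Tree≤ L Cap (StepSeq i k l 0)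
    count-step-zero i k l hp = relax (≤-trans (lit≤ {2} {60}) (≤Cap 0 0 60 lit≤))
      (reorder (weaken (Count (suc i) l 0 ∷ []) (AnyClash ∷ []) (listed hp)
             ((small-Count (suc i) l 0 ∷ small-Pig i (n ∸ k) ∷ [] , small-AnyClash ∷ small-Count i l 1 ∷ []) , lit≤K))
           (swap _ _ ↭-refl , ↭-refl)
           ((small-Pig i (n ∸ k) ∷ small-Count (suc i) l 0 ∷ [] , small-AnyClash ∷ small-Count i l 1 ∷ []) , lit≤K))

    count-step-base : ∀ {L} i k t → 1 ≤ i → i ≤ N → k < n → suc t ≤ N →
            Has L (MonoSeq i k (suc t)) → Tree≤ L Cap (StepSeq i k (suc k) (suc t))
    count-step-base {L} i k t 1≤i i≤ k<n t≤ mono =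
      relax (Count-left≤Cap 3 6 14 lit≤)
        (reorder (Count-left (suc i) k t (s≤s i≤) (≤-trans t≤ (n≤1+n _)) first rest (fitsWith⇒fits {1} (fits (small-CountDef (suc i) k t))) (fits (small-Count (suc i) (suc k) (suc t))))
          (swap _ _ ↭-refl , ↭-refl) (fitsWith⇒fits {1} (fitsWith-resp-≈ {1} (swap _ _ ↭-refl , ↭-refl) (fits (small-Count (suc i) (suc k) (suc t))))))
      where
      h = n ∸ k
      i≤' = ≤-trans i≤ (n≤1+n _)
      Pv = Pig i h
      Y = Count i (suc k) (suc (suc t))
      fits : ∀ {A} → Small A → FitsWith 1 (A ∷ Pv ∷ [] , AnyClash ∷ Y ∷ [])
      fits a = (a ∷ small-Pig i h ∷ [] , small-AnyClash ∷ small-Count i (suc k) (suc (suc t)) ∷ []) , lit≤K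
      first : Tree≤ L (6 * K + 14) (Count (suc i) k (suc t) ∷ Pv ∷ [] , AnyClash ∷ Y ∷ [])
      first = relax (≤-trans (shift≤ (2 * K) 9 5 14 lit≤) (+-monoˡ-≤ 14 (*-monoˡ-≤ K (lit≤ {2} {6}))))
                (rule₁ (wkR (Pv ∷ Ts ∷ []) (Y ∷ []) AnyClash) (swap _ _ ↭-refl , ↭-refl) (fitsWith⇒fits {1} (fits (small-Count (suc i) k (suc t)))) (Count-right i k (suc t) i≤' (s≤s t≤) (some-placement i k (suc t) i ≤-refl i≤ placed-here) (fitsΓ (small-CountDef i k (suc t))) (fitsΓ (small-Count i (suc k) (suc (suc t))))))
        where
        Ts = Count (suc i) k (suc t)
        fitsΓ : ∀ {A} → Small A → FitsWith 1 (Pv ∷ Ts ∷ [] , A ∷ [])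
        fitsΓ a = (small-Pig i h ∷ small-Count (suc i) k (suc t) ∷ [] , a ∷ []) , lit≤K
        placed-here : Tree≤ L 6 (Pv ∷ Ts ∷ [] , placed i k (suc t) i ∷ [])
        placed-here =
          pd0-right (rule₁ (wkL (Pv ∷ []) (Pv ∷ []) Ts) (swap _ _ ↭-refl , ↭-refl) (fitsWith⇒fits {1} (fitsΓ (small-Pig i h)))
                      (rule₀ (initp (i , h)) ≈-refl ((small-Pig i h ∷ [] , small-Pig i h ∷ []) , lit≤K)))
                    (rule₁ (wkL (Ts ∷ []) (Count i k (suc t) ∷ []) Pv) ≈-refl (fitsWith⇒fits {1} (fitsΓ (small-Count i k (suc t)))) (listed mono))
                    (fitsΓ (small-placed i h i k (suc t)))
      rest : ∀ x → suc i ≤ x → x ≤ N → Tree≤ L (6 * K + 14) (placed (suc i) k t x ∷ Pv ∷ [] , AnyClash ∷ Y ∷ [])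
      rest x i<x x≤N = relax (≤-reflexive (+-comm 14 (6 * K)))
        (pd0-left (reorder (weaken (X ∷ []) (Y ∷ []) (clash i x h 1≤i i<x x≤N (m<n⇒0<n∸m k<n) (m∸n≤m n k))
                     ((small-Count (suc i) k t ∷ small-Pig i h ∷ small-Pig x h ∷ [] , small-Count i (suc k) (suc (suc t)) ∷ small-AnyClash ∷ []) , lit≤K))
                     (↭-trans (prep X (swap _ _ ↭-refl)) (swap _ _ ↭-refl) , swap _ _ ↭-refl)
                     ((small-Pig x h ∷ small-Count (suc i) k t ∷ small-Pig i h ∷ [] , small-AnyClash ∷ small-Count i (suc k) (suc (suc t)) ∷ []) , lit≤K))
                  (fitsWith⇒fits {1} (fits (small-placed x h (suc i) k t))))
        where
        X = Count (suc i) k t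

    count-step-next : ∀ {L} i k l t → i ≤ N → suc t ≤ N →
            Has L (StepSeq i k l (suc t)) → Has L (StepSeq i k l t) → Tree≤ L Cap (StepSeq i k (suc l) (suc t))
    count-step-next {L} i k l t i≤ t≤ above below =
      relax (Count-left≤Cap 3 2 22 lit≤)
        (reorder (Count-left (suc i) l t (s≤s i≤) (≤-trans t≤ (n≤1+n _)) first rest (fitsWith⇒fits {1} (fits (small-CountDef (suc i) l t))) (fits (small-Count (suc i) (suc l) (suc t))))
          (swap _ _ ↭-refl , ↭-refl) (fitsWith⇒fits {1} (fitsWith-resp-≈ {1} (swap _ _ ↭-refl , ↭-refl) (fits (small-Count (suc i) (suc l) (suc t))))))
      where
      h = n ∸ k
      i≤' = ≤-trans i≤ (n≤1+n _)
      Pv = Pig i h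
      Y = Count i (suc l) (suc (suc t))
      fits : ∀ {A} → Small A → FitsWith 1 (A ∷ Pv ∷ [] , AnyClash ∷ Y ∷ [])
      fits a = (a ∷ small-Pig i h ∷ [] , small-AnyClash ∷ small-Count i (suc l) (suc (suc t)) ∷ []) , lit≤K
      first : Tree≤ L (2 * K + 22) (Count (suc i) l (suc t) ∷ Pv ∷ [] , AnyClash ∷ Y ∷ [])
      first = relax (shift≤ (2 * K) 3 5 22 lit≤)
        (reorder (Count-right i l (suc t) i≤' (s≤s t≤) (here (reorder (listed above) (↭-refl , swap _ _ ↭-refl) (fitsWith⇒fits {1} (fitsΓ (small-Count i l (suc (suc t)))))))
                    (fitsΓ (small-CountDef i l (suc t))) (fitsΓ (small-Count i (suc l) (suc (suc t)))))
          (swap _ _ ↭-refl , swap _ _ ↭-refl) (fitsWith⇒fits {1} (fits (small-Count (suc i) l (suc t)))))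
        where
        fitsΓ : ∀ {A} → Small A → FitsWith 1 (Pv ∷ Count (suc i) l (suc t) ∷ [] , A ∷ AnyClash ∷ [])
        fitsΓ a = (small-Pig i h ∷ small-Count (suc i) l (suc t) ∷ [] , a ∷ small-AnyClash ∷ []) , lit≤K
      rest : ∀ x → suc i ≤ x → x ≤ N → Tree≤ L (2 * K + 22) (placed (suc i) l t x ∷ Pv ∷ [] , AnyClash ∷ Y ∷ [])
      rest x i<x x≤N = relax (shift≤ (2 * K) 17 5 22 lit≤)
        (pd0-left (reorder collect (↭-refl , swap _ _ ↭-refl)
                     ((small-Pig x h' ∷ small-Count (suc i) l t ∷ small-Pig i h ∷ [] , small-AnyClash ∷ small-Count i (suc l) (suc (suc t)) ∷ []) , lit≤K))
                  (fitsWith⇒fits {1} (fits (small-placed x h' (suc i) l t))))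
        where
        h' = n ∸ l
        Q = Pig x h'
        X = Count (suc i) l t
        fitsΓ : ∀ {A} → Small A → FitsWith 1 (Q ∷ X ∷ Pv ∷ [] , A ∷ AnyClash ∷ [])
        fitsΓ a = (small-Pig x h' ∷ small-Count (suc i) l t ∷ small-Pig i h ∷ [] , a ∷ small-AnyClash ∷ []) , lit≤K
        y0 = reorder (weaken (X ∷ Pv ∷ []) (AnyClash ∷ []) (rule₀ (initp (x , h')) ≈-refl ((small-Pig x h' ∷ [] , small-Pig x h' ∷ []) , lit≤K))
                   ((small-Count (suc i) l t ∷ small-Pig i h ∷ small-Pig x h' ∷ [] , small-AnyClash ∷ small-Pig x h' ∷ []) , lit≤K))
                 (↭-trans (prep X (swap _ _ ↭-refl)) (swap _ _ ↭-refl) , swap _ _ ↭-refl)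
                 (fitsWith⇒fits {1} (fitsΓ (small-Pig x h')))
        y1 = rule₁ (wkL (Pv ∷ X ∷ []) (AnyClash ∷ Count i l (suc t) ∷ []) Q) (prep Q (swap _ _ ↭-refl) , swap _ _ ↭-refl)
               (fitsWith⇒fits {1} (fitsΓ (small-Count i l (suc t)))) (listed below)
        collect = Count-right i l (suc t) i≤' (s≤s t≤)
          (some-placement i l (suc t) x (≤-trans (n≤1+n i) i<x) x≤N (pd0-right y0 y1 (fitsΓ (small-placed x h' i l (suc t)))))
          (fitsΓ (small-CountDef i l (suc t))) (fitsΓ (small-Count i (suc l) (suc (suc t))))

    OverflowSeq : ℕ → ℕ → PSequent
    OverflowSeq k t = Count 1 k t ∷ [] , []

    overflow-zero : ∀ {L} t → suc t ≤ N → Tree≤ L Cap (OverflowSeq 0 (suc t))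
    overflow-zero t t≤ = relax (≤-trans (lit≤ {6} {60}) (≤Cap 0 0 60 lit≤))
      (cut-merge {Γ1 = Count 1 0 (suc t) ∷ []} {[]} {[]} {[]} (unfoldL 1 0 (suc t) (s≤s z≤n) (≤-trans t≤ (n≤1+n _)))
        (0-left ((small-0 ∷ [] , []) , lit≤K)) small-0 ((small-Count 1 0 (suc t) ∷ [] , []) , lit≤K))

    overflow-step : ∀ {L} k t → suc t ≤ N → Has L (OverflowSeq k (suc t)) → Has L (OverflowSeq k t) → Tree≤ L Cap (OverflowSeq (suc k) (suc t))
    overflow-step {L} k t t≤ above below =
      relax (Count-left≤Cap 0 0 3 lit≤)
        (Count-left 1 k t (s≤s z≤n) (≤-trans t≤ (n≤1+n _)) (relax z≤n (listed above)) rest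
          ((small-CountDef 1 k t ∷ [] , []) , lit≤K) ((small-Count 1 (suc k) (suc t) ∷ [] , []) , lit≤K))
      where
      rest : ∀ x → 1 ≤ x → x ≤ N → Tree≤ L 3 (placed 1 k t x ∷ [] , [])
      rest x _ _ = pd0-left (rule₁ (wkL (Count 1 k t ∷ []) [] (Pig x (n ∸ k))) ≈-refl ((small-Pig x (n ∸ k) ∷ small-Count 1 k t ∷ [] , []) , lit≤K) (listed below))
                     ((small-placed x (n ∸ k) 1 k t ∷ [] , []) , lit≤K)

    small-Rows : ∀ a m → All Small (Rows a m)
    small-Rows a m = All-map-fromTo Row a m (λ x _ _ → small-Row x)

    fits-Rows : ∀ a m xs ys → m ≤ N → All Small xs → All Small ys → length xs + length ys ≤ 8 → Fits (xs ++ Rows a m , ys)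
    fits-Rows a m xs ys m≤ fx fy le =
      fits-resp-≈ (↭-refl , ↭-reflexive (++-identityʳ ys))
        (fits-++ xs ys {c = 8} fx fy le ((small-Rows a m , []) ,
          ≤-trans (≤-reflexive (trans (cong (8 +_) (trans (+-identityʳ _) (length-map-fromTo Row a m))) (+-comm 8 m)))
                  (≤-trans (+-monoˡ-≤ 8 m≤) N+8≤K)))

    RowSeq : ℕ → ℕ → PSequent
    RowSeq i m = Row i ∷ Count (suc i) n m ∷ [] , AnyClash ∷ Count i n (suc m) ∷ []

    row-count : ∀ {L} i m → (∀ j → 1 ≤ j → j < 1 + n → Has L (StepSeq i (n ∸ j) n m)) → Tree≤ L Cap (RowSeq i m)
    row-count {L} i m hL = relax bound
      (⋁-left (map (Pig i) (fromTo 1 n))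
        (All-map-fromTo (Pig i) 1 n (λ j a b → listed (subst (λ z → Has L (Pig i z ∷ Count (suc i) n m ∷ [] , AnyClash ∷ Count i n (suc m) ∷ []))
                                              (m∸[m∸n]≡n (≤-pred b)) (hL j a b))))
        ((small-Row i ∷ small-Count (suc i) n m ∷ [] , small-AnyClash ∷ small-Count i n (suc m) ∷ []) , lit≤K))
      where
      bound : length (map (Pig i) (fromTo 1 n)) * 1 + suc K ≤ Cap
      bound = ≤-trans (+-monoˡ-≤ (suc K) (≤-trans (≤-reflexive (*-identityʳ _)) (≤-trans (≤-reflexive (length-map-fromTo (Pig i) 1 n)) (≤-trans (n≤1+n _) (≤-trans (n≤1+n _) N<K)))))
              (≤-trans (≤-reflexive (lemB K)) (≤Cap 0 2 1 lit≤))
        where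
        lemB : ∀ k → k + suc k ≡ 0 * (k * k) + 2 * k + 1
        lemB = solve-∀

    RowsSeq : ℕ → ℕ → PSequent
    RowsSeq i m = Rows i m , AnyClash ∷ Count i n m ∷ []

    rows-count-first : ∀ {L} → Has L (RowSeq N 0) → Tree≤ L Cap (RowsSeq N 1)
    rows-count-first hA = relax (≤-trans lit≤ (≤Cap 0 0 60 lit≤))
      (cut-merge {Γ1 = []} {[]} {Row N ∷ []} {AnyClash ∷ Count N n 1 ∷ []}
        (cut-merge {Γ1 = []} {[]} {[]} {Count (suc N) n 0 ∷ []} (rule₀ init1 ≈-refl (([] , small-1 ∷ []) , lit≤K))
          (unfoldR (suc N) n 0 ≤-refl z≤n) small-1 (([] , small-Count (suc N) n 0 ∷ []) , lit≤K))
        (reorder (listed hA) (swap _ _ ↭-refl , ↭-refl) ((small-Count (suc N) n 0 ∷ small-Row N ∷ [] , small-AnyClash ∷ small-Count N n 1 ∷ []) , lit≤K))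
        (small-Count (suc N) n 0) ((small-Row N ∷ [] , small-AnyClash ∷ small-Count N n 1 ∷ []) , lit≤K))

    fits⇒fitsWith : ∀ {A Γ Δ} → Fits (A ∷ Γ , Δ) → FitsWith 1 (Γ , Δ)
    fits⇒fitsWith ((_ ∷ fΓ , fΔ) , l) = (fΓ , fΔ) , l

    rows-count-step : ∀ {L} i m → suc m ≤ N → Has L (RowsSeq (suc i) m) → Has L (RowSeq i m) → Tree≤ L Cap (RowsSeq i (suc m))
    rows-count-step {L} i m m< hZ hA = relax bound contracted
      where
      -- Cut on Count (i+1) n m, then contract the two copies of R.
      m≤ = ≤-trans (n≤1+n m) m<
      Rs = Rows (suc i) m
      rows-part = reorder (listed hZ) (↭-refl , swap _ _ ↭-refl) (fits-Rows (suc i) m [] (Count (suc i) n m ∷ AnyClash ∷ []) m≤ [] (small-Count (suc i) n m ∷ small-AnyClash ∷ []) lit≤)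
      row-part = reorder (listed hA) (swap _ _ ↭-refl , ↭-refl) ((small-Count (suc i) n m ∷ small-Row i ∷ [] , small-AnyClash ∷ small-Count i n (suc m) ∷ []) , lit≤K)
      -- The p0 only reserves room for the cut formula.
      fits-cut = fits⇒fitsWith (fits-resp-≈ (prep p0 (↭-sym (PermP.++-comm Rs (Row i ∷ []))) , ↭-refl)
              (fits-Rows (suc i) m (p0 ∷ Row i ∷ []) (AnyClash ∷ AnyClash ∷ Count i n (suc m) ∷ []) m≤ (small-0 ∷ small-Row i ∷ []) (small-AnyClash ∷ small-AnyClash ∷ small-Count i n (suc m) ∷ []) lit≤))
      cut-both = cut-merge {Γ1 = Rs} {AnyClash ∷ []} {Row i ∷ []} {AnyClash ∷ Count i n (suc m) ∷ []} rows-part row-part (small-Count (suc i) n m) fits-cut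
      contracted = rule₁ (ctrR (Rs ++ Row i ∷ []) (Count i n (suc m) ∷ []) AnyClash) (PermP.++-comm Rs (Row i ∷ []) , ↭-refl)
             (fits-Rows (suc i) m (Row i ∷ []) (AnyClash ∷ Count i n (suc m) ∷ []) m≤ (small-Row i ∷ []) (small-AnyClash ∷ small-Count i n (suc m) ∷ []) lit≤) cut-both
      bound : suc (suc ((1 + (2 + 0)) + (length Rs + (1 + 0)))) ≤ Cap
      bound = ≤-trans (≤-reflexive (lemA (length Rs)))
              (≤-trans (+-monoʳ-≤ 6 (≤-trans (≤-reflexive (length-map-fromTo Row (suc i) m)) (≤-trans m≤ (≤-trans (n≤1+n _) N<K))))
                (≤-trans (≤-reflexive (lemB K)) (≤Cap 0 1 6 lit≤)))
        where
        lemA : ∀ l → suc (suc ((1 + (2 + 0)) + (l + (1 + 0)))) ≡ 6 + l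
        lemA = solve-∀
        lemB : ∀ k → 6 + k ≡ 0 * (k * k) + 1 * k + 6
        lemB = solve-∀

    count-mono : ∀ {L} i k t → i ≤ N → t < suc N →
             (∀ k' → suc k' ≡ k → ∀ t' → t' < suc N → Has L (MonoSeq i k' t')) → Tree≤ L Cap (MonoSeq i k t)
    count-mono i k zero i≤ t< prev = relax (≤Cap 0 0 9 lit≤) (count-mono-base i k zero refl i≤ z≤n)
    count-mono i zero (suc t) i≤ t< prev = relax (≤Cap 0 0 9 lit≤) (count-mono-base i zero (suc t) refl i≤ (<⇒≤ t<))
    count-mono i (suc k) (suc t) i≤ t< prev =
      count-mono-step i k t i≤ (<⇒≤ t<) (prev k refl (suc t) t<) (prev k refl t (≤-trans (n≤1+n _) t<))

    MonoAll : List PSequent → Set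
    MonoAll L = ∀ x → x < N → ∀ k → k < n → ∀ t → t < suc N → Has L (MonoSeq (suc x) k t)

    abstract
      phase-mono : ∀ {L} → Valid L → Result L (N * (n * (suc N * Cap))) MonoAll
      phase-mono {L₀} st = iterate N DoneFor (λ e h k k< t t< → Has-extends e (h k k< t t<)) _ stepₓ st
        where
        DoneFor : ℕ → List PSequent → Set
        DoneFor x L = ∀ k → k < n → ∀ t → t < suc N → Has L (MonoSeq (suc x) k t)
        stepₓ : ∀ x → x < N → ∀ {L j} → Extends L₀ L j → Valid L → (∀ y → y < x → DoneFor y L) → Result L (n * (suc N * Cap)) (DoneFor x)
        stepₓ x x< {L₁} _ st _ = iterate n DoneFor₂ (λ e h t t< → Has-extends e (h t t<)) _ stepₖ st
          where
          DoneFor₂ : ℕ → List PSequent → Set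
          DoneFor₂ k L = ∀ t → t < suc N → Has L (MonoSeq (suc x) k t)
          stepₖ : ∀ k → k < n → ∀ {L j} → Extends L₁ L j → Valid L → (∀ y → y < k → DoneFor₂ y L) → Result L (suc N * Cap) (DoneFor₂ k)
          stepₖ k k< {L₂} _ st earlier = iterate (suc N) (λ t L → Has L (MonoSeq (suc x) k t)) Has-extends Cap stepₜ st
            where
            stepₜ : ∀ t → t < suc N → ∀ {L j} → Extends L₂ L j → Valid L → (∀ y → y < t → Has L (MonoSeq (suc x) k y)) →
                    Result L Cap (λ L' → Has L' (MonoSeq (suc x) k t))
            stepₜ t t< e st _ = record-tree (count-mono (suc x) k t x< t<
                                  (λ k' eq t' t'< → Has-extends e (earlier k' (subst (k' <_) eq ≤-refl) t' t'<))) st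

    PigeonAll : List PSequent → Set
    PigeonAll L = ∀ x → x < N → ∀ k → k < n → ∀ l → l < suc n → k < l → Has L (PigeonSeq (suc x) k l)

    abstract
      phase-pigeon : ∀ {L} → Valid L → Result L (N * (n * (suc n * Cap))) PigeonAll
      phase-pigeon {L₀} st = iterate N DoneFor (λ e h k k< l l< k<l → Has-extends e (h k k< l l< k<l)) _ stepₓ st
        where
        DoneFor : ℕ → List PSequent → Set
        DoneFor x L = ∀ k → k < n → ∀ l → l < suc n → k < l → Has L (PigeonSeq (suc x) k l)
        stepₓ : ∀ x → x < N → ∀ {L j} → Extends L₀ L j → Valid L → (∀ y → y < x → DoneFor y L) → Result L (n * (suc n * Cap)) (DoneFor x)
        stepₓ x x< {L₁} _ st _ = iterate n DoneFor₂ (λ e h l l< k<l → Has-extends e (h l l< k<l)) _ stepₖ st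
          where
          DoneFor₂ : ℕ → List PSequent → Set
          DoneFor₂ k L = ∀ l → l < suc n → k < l → Has L (PigeonSeq (suc x) k l)
          stepₖ : ∀ k → k < n → ∀ {L j} → Extends L₁ L j → Valid L → (∀ y → y < k → DoneFor₂ y L) → Result L (suc n * Cap) (DoneFor₂ k)
          stepₖ k k< {L₂} _ st _ = iterate (suc n) (λ l L → k < l → Has L (PigeonSeq (suc x) k l)) (λ e h k<l → Has-extends e (h k<l)) Cap stepₗ st
            where
            stepₗ : ∀ l → l < suc n → ∀ {L j} → Extends L₂ L j → Valid L → (∀ y → y < l → k < y → Has L (PigeonSeq (suc x) k y)) →
                    Result L Cap (λ L' → k < l → Has L' (PigeonSeq (suc x) k l))
            stepₗ zero _ e st _ = nothing-new st (λ ())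
            stepₗ (suc l) l< e st earlier with k ≟ l
            ... | yes refl = Result-map (λ h _ → h) (record-tree (pigeon-counts-base (suc x) k x<) st)
            ... | no k≢l with k <? l
            ...   | yes k<l = Result-map (λ h _ → h) (record-tree (pigeon-counts-step (suc x) k l x< (earlier l ≤-refl k<l)) st)
            ...   | no k≮l = nothing-new st (λ k<sl → ⊥-elim (k≮l (≤∧≢⇒< (≤-pred k<sl) k≢l)))

    StepAll : List PSequent → Set
    StepAll L = ∀ x → x < N → ∀ k → k < n → ∀ l → l < suc n → k < l → ∀ t → t < N → Has L (StepSeq (suc x) k l t)

    abstract
      phase-step : ∀ {L} → Valid L → MonoAll L → PigeonAll L → Result L (N * (n * (suc n * (N * Cap)))) StepAll
      phase-step {L₀} st monoAll pigeonAll = iterate N DoneFor (λ e h k k< l l< k<l t t< → Has-extends e (h k k< l l< k<l t t<)) _ stepₓ st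
        where
        DoneFor : ℕ → List PSequent → Set
        DoneFor x L = ∀ k → k < n → ∀ l → l < suc n → k < l → ∀ t → t < N → Has L (StepSeq (suc x) k l t)
        stepₓ : ∀ x → x < N → ∀ {L j} → Extends L₀ L j → Valid L → (∀ y → y < x → DoneFor y L) → Result L (n * (suc n * (N * Cap))) (DoneFor x)
        stepₓ x x< {L₁} e₁ st _ = iterate n DoneFor₂ (λ e h l l< k<l t t< → Has-extends e (h l l< k<l t t<)) _ stepₖ st
          where
          DoneFor₂ : ℕ → List PSequent → Set
          DoneFor₂ k L = ∀ l → l < suc n → k < l → ∀ t → t < N → Has L (StepSeq (suc x) k l t)
          stepₖ : ∀ k → k < n → ∀ {L j} → Extends L₁ L j → Valid L → (∀ y → y < k → DoneFor₂ y L) → Result L (suc n * (N * Cap)) (DoneFor₂ k)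
          stepₖ k k< {L₂} e₂ st _ = iterate (suc n) DoneFor₃ (λ e h k<l t t< → Has-extends e (h k<l t t<)) _ stepₗ st
            where
            DoneFor₃ : ℕ → List PSequent → Set
            DoneFor₃ l L = k < l → ∀ t → t < N → Has L (StepSeq (suc x) k l t)
            stepₗ : ∀ l → l < suc n → ∀ {L j} → Extends L₂ L j → Valid L → (∀ y → y < l → DoneFor₃ y L) → Result L (N * Cap) (DoneFor₃ l)
            stepₗ zero l< e₃ st _ = nothing-new st (λ ())
            stepₗ (suc l') l< {L₃} e₃ st earlier with k <? suc l'
            ... | no k≮l = nothing-new st (λ k<l → ⊥-elim (k≮l k<l))
            ... | yes k<l = Result-map (λ h _ → h) (iterate N (λ t L → Has L (StepSeq (suc x) k (suc l') t)) Has-extends Cap stepₜ st)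
              where
              e₀₃ : Σ ℕ (Extends L₀ L₃)
              e₀₃ = _ , extends-trans (extends-trans e₁ e₂) e₃
              stepₜ : ∀ t → t < N → ∀ {L j} → Extends L₃ L j → Valid L → (∀ y → y < t → Has L (StepSeq (suc x) k (suc l') y)) →
                      Result L Cap (λ L' → Has L' (StepSeq (suc x) k (suc l') t))
              stepₜ zero t< e₄ st _ =
                record-tree (count-step-zero (suc x) k (suc l') (Has-extends (extends-trans (proj₂ e₀₃) e₄) (pigeonAll x x< k k< (suc l') l< k<l))) st
              stepₜ (suc t) t< e₄ st _ with k ≟ l'
              ... | yes refl = record-tree (count-step-base (suc x) k t (s≤s z≤n) x< k< (≤-trans (n≤1+n _) t<)
                                 (Has-extends (extends-trans (proj₂ e₀₃) e₄) (monoAll x x< k k< (suc t) (≤-trans t< (n≤1+n _))))) st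
              ... | no k≢l' = record-tree (count-step-next (suc x) k l' t x< (≤-trans (n≤1+n _) t<)
                                 (Has-extends e₄ (earlier l' ≤-refl k<l' (suc t) t<))
                                 (Has-extends e₄ (earlier l' ≤-refl k<l' t (≤-trans (n≤1+n _) t<)))) st
                where
                k<l' : k < l'
                k<l' = ≤∧≢⇒< (≤-pred k<l) k≢l'

    overflow : ∀ {L} k t → suc t < suc N → k < suc t →
          (∀ k' → suc k' ≡ k → ∀ t' → t' < suc N → k' < t' → Has L (OverflowSeq k' t')) → Tree≤ L Cap (OverflowSeq k (suc t))
    overflow zero t t< kt earlier = overflow-zero t (≤-pred t<)
    overflow (suc k') t t< kt earlier =
      overflow-step k' t (≤-pred t<) (earlier k' refl (suc t) t< (≤-trans (n≤1+n _) kt)) (earlier k' refl t (≤-trans (n≤1+n _) t<) (≤-pred kt))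

    OverflowAll : List PSequent → Set
    OverflowAll L = ∀ k → k < suc n → ∀ t → t < suc N → k < t → Has L (OverflowSeq k t)

    abstract
      phase-overflow : ∀ {L} → Valid L → Result L (suc n * (suc N * Cap)) OverflowAll
      phase-overflow {L₀} st = iterate (suc n) DoneFor (λ e h t t< kt → Has-extends e (h t t< kt)) _ stepₖ st
        where
        DoneFor : ℕ → List PSequent → Set
        DoneFor k L = ∀ t → t < suc N → k < t → Has L (OverflowSeq k t)
        stepₖ : ∀ k → k < suc n → ∀ {L j} → Extends L₀ L j → Valid L → (∀ y → y < k → DoneFor y L) → Result L (suc N * Cap) (DoneFor k)
        stepₖ k k< {L₁} _ st earlier = iterate (suc N) (λ t L → k < t → Has L (OverflowSeq k t)) (λ e h kt → Has-extends e (h kt)) Cap stepₜ st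
          where
          stepₜ : ∀ t → t < suc N → ∀ {L j} → Extends L₁ L j → Valid L → (∀ y → y < t → k < y → Has L (OverflowSeq k y)) →
                  Result L Cap (λ L' → k < t → Has L' (OverflowSeq k t))
          stepₜ zero _ _ st _ = nothing-new st (λ ())
          stepₜ (suc t) t< e st _ with k <? suc t
          ... | no k≮ = nothing-new st (λ kt → ⊥-elim (k≮ kt))
          ... | yes kt = Result-map (λ h _ → h)
                           (record-tree (overflow k t t< kt (λ k' eq t' t'< kt' → Has-extends e (earlier k' (subst (k' <_) eq ≤-refl) t' t'< kt'))) st)

    n∸j<n : ∀ j → 1 ≤ j → j ≤ n → n ∸ j < n
    n∸j<n (suc j) _ j≤ = ≤-trans (≤-reflexive (sym (+-∸-assoc 1 j≤))) (m∸n≤m n j)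

    RowAll : List PSequent → Set
    RowAll L = ∀ x → x < N → Has L (RowSeq (suc x) (n ∸ x))

    abstract
      phase-row : ∀ {L} → Valid L → StepAll L → Result L (N * Cap) RowAll
      phase-row {L₀} st stepAll = iterate N (λ x L → Has L (RowSeq (suc x) (n ∸ x))) Has-extends Cap stepₓ st
        where
        stepₓ : ∀ x → x < N → ∀ {L j} → Extends L₀ L j → Valid L → (∀ y → y < x → Has L (RowSeq (suc y) (n ∸ y))) →
                Result L Cap (λ L' → Has L' (RowSeq (suc x) (n ∸ x)))
        stepₓ x x< e st _ = record-tree (row-count (suc x) (n ∸ x)
          (λ j 1≤j j< → Has-extends e (stepAll x x< (n ∸ j) (n∸j<n j 1≤j (≤-pred j<)) n ≤-refl (n∸j<n j 1≤j (≤-pred j<))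
                                      (n ∸ x) (s≤s (m∸n≤m n x))))) st

    RowsAll : List PSequent → Set
    RowsAll L = ∀ x → x < N → Has L (RowsSeq (N ∸ x) (suc x))

    rows-count : ∀ {L} x → x < N → RowAll L → (∀ x' → suc x' ≡ x → Has L (RowsSeq (N ∸ x') (suc x'))) → Tree≤ L Cap (RowsSeq (N ∸ x) (suc x))
    rows-count {L} zero _ rowAll _ = rows-count-first (subst (λ m → Has L (RowSeq N m)) (n∸n≡0 n) (rowAll n ≤-refl))
    rows-count {L} (suc x') x< rowAll earlier =
      rows-count-step (n ∸ x') (suc x') x<
        (subst (λ i → Has L (RowsSeq i (suc x'))) (+-∸-assoc 1 x'≤) (earlier x' refl))
        (subst₂ (λ i m → Has L (RowSeq i m)) eq1 eq2 (rowAll (n ∸ suc x') (s≤s (m∸n≤m n (suc x')))))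
      where
      x'≤ : x' ≤ n
      x'≤ = ≤-pred (≤-trans (n≤1+n _) x<)
      sx≤ : suc x' ≤ n
      sx≤ = ≤-pred x<
      eq1 : suc (n ∸ suc x') ≡ n ∸ x'
      eq1 = sym (+-∸-assoc 1 sx≤)
      eq2 : n ∸ (n ∸ suc x') ≡ suc x'
      eq2 = m∸[m∸n]≡n sx≤

    abstract
      phase-rows : ∀ {L} → Valid L → RowAll L → Result L (N * Cap) RowsAll
      phase-rows {L₀} st rowAll = iterate N (λ x L → Has L (RowsSeq (N ∸ x) (suc x))) Has-extends Cap stepₓ st
        where
        stepₓ : ∀ x → x < N → ∀ {L j} → Extends L₀ L j → Valid L → (∀ y → y < x → Has L (RowsSeq (N ∸ y) (suc y))) →
                Result L Cap (λ L' → Has L' (RowsSeq (N ∸ x) (suc x)))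
        stepₓ x x< e st earlier = record-tree (rows-count x x< (λ y y< → Has-extends e (rowAll y y<)) (λ x' eq → earlier x' (subst (x' <_) eq ≤-refl))) st

    abstract
      goal-tree : ∀ {L} → Has L (RowsSeq 1 N) → Has L (OverflowSeq n N) → Tree≤ L Cap Goal
      goal-tree hZ hE = relax bound
        (reorder (cut-merge {Γ1 = Rows 1 N} {AnyClash ∷ []} {[]} {[]}
               (reorder (listed hZ) (↭-refl , swap _ _ ↭-refl) (fits-Rows 1 N [] (Count 1 n N ∷ AnyClash ∷ []) ≤-refl [] (small-Count 1 n N ∷ small-AnyClash ∷ []) lit≤))
               (listed hE) (small-Count 1 n N)
               (fits⇒fitsWith (fits-resp-≈ (prep p0 (↭-sym (↭-reflexive (++-identityʳ (Rows 1 N)))) , ↭-refl)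
                  (fits-Rows 1 N (p0 ∷ []) (AnyClash ∷ []) ≤-refl (small-0 ∷ []) (small-AnyClash ∷ []) lit≤))))
             (↭-reflexive (++-identityʳ (Rows 1 N)) , ↭-refl)
             (fits-Rows 1 N [] (AnyClash ∷ []) ≤-refl [] (small-AnyClash ∷ []) lit≤))
        where
        bound : suc ((0 + (0 + 0)) + (length (Rows 1 N) + (1 + 0))) ≤ Cap
        bound = ≤-trans (≤-reflexive (lemA (length (Rows 1 N))))
                (≤-trans (+-monoʳ-≤ 2 (≤-trans (≤-reflexive (length-map-fromTo Row 1 N)) (≤-trans (n≤1+n _) N<K)))
                  (≤-trans (≤-reflexive (lemB K)) (≤Cap 0 1 2 lit≤)))
          where
          lemA : ∀ l → suc ((0 + (0 + 0)) + (l + (1 + 0))) ≡ 2 + l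
          lemA = solve-∀
          lemB : ∀ k → 2 + k ≡ 0 * (k * k) + 1 * k + 2
          lemB = solve-∀

    TotalBound : ℕ
    TotalBound = N * (n * (suc N * Cap)) + (N * (n * (suc n * Cap)) + (N * (n * (suc n * (N * Cap)))
           + (suc n * (suc N * Cap) + (N * Cap + (N * Cap + Cap)))))

    abstract
      run : Result [] TotalBound (λ L → Has L Goal)
      run =
        bind (phase-mono {[]} ([] , [])) λ _ st₁ monoAll →
        bind (phase-pigeon st₁) λ (_ , e₂) st₂ pigeonAll →
        bind (phase-step st₂ (λ x x< k k< t t< → Has-extends e₂ (monoAll x x< k k< t t<)) pigeonAll) λ _ st₃ stepAll →
        bind (phase-overflow st₃) λ (_ , e₄) st₄ overflowAll →
        bind (phase-row st₄ (λ x x< k k< l l< k<l t t< → Has-extends e₄ (stepAll x x< k k< l l< k<l t t<))) λ (_ , e₅) st₅ rowAll →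
        bind (phase-rows st₅ rowAll) λ {L₆} (_ , e₆) st₆ rowsAll →
        record-tree (goal-tree (subst (λ i → Has L₆ (RowsSeq i N)) (m+n∸n≡m 1 n) (rowsAll n ≤-refl))
                               (Has-extends e₆ (Has-extends e₅ (overflowAll n ≤-refl N ≤-refl ≤-refl)))) st₆

  module Sizes (K : ℕ) (K≥ : N + 8 ≤ K) where
    -- Size bounds for disjunctions of at most K disjuncts of size at most 6, and for
    -- the next two levels of nesting.
    S1 S2 S3 : ℕ
    S1 = suc (K * 7)
    S2 = suc (K * suc S1)
    S3 = suc (K * suc S2)

    1≤K : 1 ≤ K
    1≤K = ≤-trans (s≤s z≤n) (≤-trans (m≤m+n N 8) K≥)

    size-⋁≤ : ∀ l b → l ≤ K → suc (l * suc b) ≤ suc (K * suc b)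
    size-⋁≤ l b le = s≤s (*-monoˡ-≤ (suc b) le)

    level≤next : ∀ b → b ≤ suc (K * suc b)
    level≤next b = ≤-trans (n≤1+n b) (≤-trans (≤-reflexive (sym (*-identityˡ (suc b)))) (≤-trans (*-monoˡ-≤ (suc b) 1≤K) (n≤1+n _)))

    S1≤S3 : S1 ≤ S3
    S1≤S3 = ≤-trans (level≤next S1) (level≤next S2)

    S2≤S3 : S2 ≤ S3
    S2≤S3 = level≤next S2

    2+N≤K : suc (suc N) ≤ K
    2+N≤K = ≤-trans (≤-trans (≤-reflexive (+-comm 2 N)) (+-monoʳ-≤ N (s≤s (s≤s z≤n)))) K≥

    n≤K : n ≤ K
    n≤K = ≤-trans (n≤1+n _) (≤-trans (n≤1+n _) (≤-trans (n≤1+n _) 2+N≤K))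

    size-ClashWith : ∀ j i → size (ClashWith j i) ≤ S1
    size-ClashWith j i = ≤-trans (size-⋁P (clashesWith j i) 6 (All-map-fromTo (Both i j) (suc i) (suc n ∸ i) (λ _ _ _ → ≤-refl)))
                (size-⋁≤ _ 6 (≤-trans (≤-reflexive (length-map-fromTo (Both i j) (suc i) (suc n ∸ i))) (≤-trans (m∸n≤m (suc n) i) (≤-trans (n≤1+n _) (≤-trans (n≤1+n _) 2+N≤K)))))

    size-HoleClash : ∀ j → size (HoleClash j) ≤ S2
    size-HoleClash j = ≤-trans (size-⋁P (holeClashes j) S1 (All-map-fromTo (ClashWith j) 1 n (λ i _ _ → size-ClashWith j i)))
              (size-⋁≤ _ S1 (≤-trans (≤-reflexive (length-map-fromTo (ClashWith j) 1 n)) n≤K))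

    size-AnyClash : size AnyClash ≤ S3
    size-AnyClash = ≤-trans (size-⋁P allClashes S2 (All-map-fromTo HoleClash 1 n (λ j _ _ → size-HoleClash j)))
              (size-⋁≤ _ S2 (≤-trans (≤-reflexive (length-map-fromTo HoleClash 1 n)) n≤K))

    size-Row : ∀ i → size (Row i) ≤ S1
    size-Row i = ≤-trans (size-⋁P (map (Pig i) (fromTo 1 n)) 6 (All-map-fromTo (Pig i) 1 n (λ _ _ _ → s≤s z≤n)))
                (size-⋁≤ _ 6 (≤-trans (≤-reflexive (length-map-fromTo (Pig i) 1 n)) n≤K))

    size-CountDef : ∀ i k t → size (CountDef i k t) ≤ S1
    size-CountDef i k t = ≤-trans (size-⋁P (Count i k (suc t) ∷ placements i k t) 6 (s≤s z≤n ∷ All-map-fromTo (placed i k t) i (suc N ∸ i) (λ _ _ _ → ≤-refl)))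
                  (size-⋁≤ _ 6 (≤-trans (s≤s (≤-trans (≤-reflexive (length-map-fromTo (placed i k t) i (suc N ∸ i))) (m∸n≤m (suc N) i))) 2+N≤K))

    sizeBounds : SizeBounds S3 K
    sizeBounds = record
      { small-AnyClash = size-AnyClash
      ; small-HoleClash = λ j → ≤-trans (size-HoleClash j) S2≤S3
      ; small-ClashWith = λ j i → ≤-trans (size-ClashWith j i) S1≤S3
      ; small-Row = λ i → ≤-trans (size-Row i) S1≤S3
      ; small-CountDef = λ i k t → ≤-trans (size-CountDef i k t) S1≤S3
      ; 6≤F = ≤-trans (s≤s (≤-trans (s≤s (s≤s (s≤s (s≤s (s≤s z≤n))))) (≤-trans (≤-reflexive (sym (*-identityˡ 7))) (*-monoˡ-≤ 7 1≤K)))) S1≤S3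
      ; N+8≤K = K≥
      }

  module Final where
    K : ℕ
    K = N + 8
    open Sizes K ≤-refl public
    open Construction S3 K sizeBounds public
    open Trees defn-at defn-wf S3 K

    php-proof : Σ (Proof (PHP n)) λ π → proofSize π ≤ TotalBound * suc (K * S3)
    php-proof with run
    ... | L , st , (k , e , k≤) , h with proof-from-list st h
    ... | π , π≤ rewrite embSeq-Goal =
      π , ≤-trans π≤ (*-monoˡ-≤ (suc (K * S3)) (≤-trans (≤-reflexive (trans (extends-length e) (+-identityʳ k))) k≤))

    N≤K : N ≤ K
    N≤K = ≤-trans (n≤1+n N) N<K

    ≤K* : ∀ {x y} → x ≤ y → x ≤ K * y
    ≤K* {x} {y} le = ≤-trans le (≤-trans (≤-reflexive (sym (*-identityˡ y))) (*-monoˡ-≤ y 1≤K))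

    suc-*-≤ : ∀ b X → 1 ≤ X → suc (b * X) ≤ suc b * X
    suc-*-≤ b X p = +-monoˡ-≤ (b * X) p

    TotalBound≤ : TotalBound ≤ 7 * (K * (K * (K * (K * Cap))))
    TotalBound≤ = ≤-trans (+-mono-≤ t1 (+-mono-≤ t2 (+-mono-≤ t3 (+-mono-≤ t4 (+-mono-≤ t5 (+-mono-≤ t5 t7))))))
            (≤-reflexive (lem (K * (K * (K * (K * Cap))))))
      where
      lem : ∀ x → x + (x + (x + (x + (x + (x + x))))) ≡ 7 * x
      lem = solve-∀
      t1 = ≤K* (*-mono-≤ N≤K (*-mono-≤ n≤K (*-mono-≤ N<K (≤-refl {Cap}))))
      t2 = ≤K* (*-mono-≤ N≤K (*-mono-≤ n≤K (*-mono-≤ N≤K (≤-refl {Cap}))))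
      t3 = *-mono-≤ N≤K (*-mono-≤ n≤K (*-mono-≤ N≤K (*-mono-≤ N≤K (≤-refl {Cap}))))
      t4 = ≤K* (≤K* (*-mono-≤ N≤K (*-mono-≤ N<K (≤-refl {Cap}))))
      t5 = ≤K* (≤K* (≤K* (*-mono-≤ N≤K (≤-refl {Cap}))))
      t7 = ≤K* (≤K* (≤K* (≤K* (≤-refl {Cap}))))

    S1≤ : suc S1 ≤ 9 * K
    S1≤ = ≤-trans (s≤s (≤-trans (s≤s (≤-reflexive (*-comm K 7))) (suc-*-≤ 7 K 1≤K))) (suc-*-≤ 8 K 1≤K)

    S2≤ : suc S2 ≤ 11 * (K * K)
    S2≤ = ≤-trans (s≤s (≤-trans (s≤s (≤-trans (*-monoʳ-≤ K S1≤) (≤-reflexive (lem K)))) (suc-*-≤ 9 (K * K) (≤K* 1≤K))))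
            (suc-*-≤ 10 (K * K) (≤K* 1≤K))
      where
      lem : ∀ q → q * (9 * q) ≡ 9 * (q * q)
      lem = solve-∀

    S3≤ : suc (K * S3) ≤ 13 * (K * (K * (K * K)))
    S3≤ = ≤-trans (s≤s (≤-trans (*-monoʳ-≤ K S3≤') (≤-reflexive (lem K)))) (suc-*-≤ 12 _ (≤K* (≤K* (≤K* 1≤K))))
      where
      S3≤' : S3 ≤ 12 * (K * (K * K))
      S3≤' = ≤-trans (s≤s (≤-trans (*-monoʳ-≤ K S2≤) (≤-reflexive (lem' K)))) (suc-*-≤ 11 _ (≤K* (≤K* 1≤K)))
        where
        lem' : ∀ q → q * (11 * (q * q)) ≡ 11 * (q * (q * q))
        lem' = solve-∀
      lem : ∀ q → q * (12 * (q * (q * q))) ≡ 12 * (q * (q * (q * q)))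
      lem = solve-∀

    size-bound : TotalBound * suc (K * S3) ≤ 5460 * K ^ 10
    size-bound = ≤-trans (*-mono-≤ TotalBound≤ S3≤) (≤-reflexive (lem K))
      where
      lem : ∀ q → (7 * (q * (q * (q * (q * (60 * (q * q))))))) * (13 * (q * (q * (q * q)))) ≡ 5460 * (q * (q * (q * (q * (q * (q * (q * (q * (q * (q * 1))))))))))
      lem = solve-∀

^-distribʳ-* : ∀ a b k → (a * b) ^ k ≡ a ^ k * b ^ k
^-distribʳ-* a b zero = refl
^-distribʳ-* a b (suc k) = trans (cong (a * b *_) (^-distribʳ-* a b k)) (lem a b (a ^ k) (b ^ k))
  where
  lem : ∀ a b x y → a * b * (x * y) ≡ a * x * (b * y)
  lem = solve-∀

n+9≤10n : ∀ n → 1 ≤ n → suc n + 8 ≤ 10 * n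
n+9≤10n (suc r) _ = ≤-trans (m≤m+n (suc (suc r) + 8) (9 * r)) (≤-reflexive (sym (lem r)))
  where
  lem : ∀ r → 10 * suc r ≡ (suc (suc r) + 8) + 9 * r
  lem = solve-∀

mainTheorem2 : Σ ℕ λ c → Σ ℕ λ k → ∀ n → 1 ≤ n →
                 Σ (Proof (PHP n)) λ π → proofSize π ≤ c * n ^ k
mainTheorem2 = 5460 * 10 ^ 10 , 10 , λ n 1≤n →
  let open Counting n
      open Final
      K≤10n = n+9≤10n n 1≤n
  in proj₁ php-proof ,
     (begin
       proofSize (proj₁ php-proof)  ≤⟨ proj₂ php-proof ⟩
       TotalBound * suc (K * S3)    ≤⟨ size-bound ⟩
       5460 * K ^ 10                ≤⟨ *-monoʳ-≤ 5460 (^-monoˡ-≤ 10 K≤10n) ⟩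
       5460 * (10 * n) ^ 10         ≡⟨ cong (5460 *_) (^-distribʳ-* 10 n 10) ⟩
       5460 * (10 ^ 10 * n ^ 10)    ≡⟨ sym (*-assoc 5460 (10 ^ 10) (n ^ 10)) ⟩
       5460 * 10 ^ 10 * n ^ 10      ∎)
  where open ≤-Reasoning
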